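{- Let $e\geq 2$ and let $\Gamma_e=VO^+(2e,2)$, realised on the set of all $2\times e$ matrices over $\mathbb{F}_2$. Let $W_1$ be the set of matrices whose second row is zero, and let $v$ be the matrix with entry $1$ in position $(2,e)$ and $0$ elsewhere. Define $V_1=\{x\in W_1: x_{1e}=1\}$, $V_2=\{x\in v+W_1: x_{1e}=0\}$, and let $C$ be the set of matrices $x$ with $x_{1e}=0$, $x_{2,e-1}=1$, $x_{2j}=0$ for all $j<e-1$ (the entries $x_{1j}$ for $j<e$ and $x_{2e}$ being arbitrary). Let $\Gamma_{e,2}$ be the graph obtained from $\Gamma_e$ by first switching the edges between $W_1$ and $v+W_1$, and then switching the edges between $V_1\cup V_2$ and $C$. Then $\Gamma_{e,2}$ is a strictly Neumaier graph that is edge-regular with parameters $$\bigl(2^{2e},\ (2^{e-1}+1)(2^e-1),\ 2(2^{e-2}+1)(2^{e-1}-1)\bigr)$$ and contains a $2^{e-1}$-regular $2^e$-clique. Further, with $\mu=2^{e-1}(2^{e-1}+1)$, the numbers of common neighbours of pairs of distinct non-adjacent vertices of $\Gamma_{e,2}$ take exactly the values $\mu-2^{e-1}$, $\mu$ and $\mu+2^{e-1}$.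
   Context: All graphs are finite, simple and undirected. For a $2\times e$ matrix $x=(x_{ij})$ over $\mathbb{F}_2$ define $Q(x)=\sum_{j=1}^{e} x_{1j}x_{2j}$ (the scalar product of its two rows). The affine polar graph $VO^+(2e,2)$ has vertex set the $2\times e$ matrices over $\mathbb{F}_2$, two distinct matrices $x,y$ adjacent iff $Q(x-y)=0$; it is strongly regular with parameters $(2^{2e},(2^{e-1}+1)(2^e-1),2(2^{e-2}+1)(2^{e-1}-1),2^{e-1}(2^{e-1}+1))$. For a set $X$ of matrices and a matrix $v$, $v+X=\{v+x:x\in X\}$. For disjoint vertex sets $S,T$ of a graph, switching the edges between $S$ and $T$ means: for each $x\in S$ and each $t\in T$, delete the edge $xt$ if present and insert it if absent. A graph on $v$ vertices is edge-regular with parameters $(v,k,\lambda)$ if it has at least one edge, is $k$-regular, and every two adjacent vertices have exactly $\lambda$ common neighbours; it is strongly regular if additionally it is non-complete and any two distinct non-adjacent vertices have a constant number of common neighbours. A clique $S$ in a regular graph is $m$-regular if every vertex outside $S$ is adjacent to exactly $m>0$ vertices of $S$. A strictly Neumaier graph is a non-complete edge-regular graph containing a regular clique which is not strongly regular. -}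

module Defs where

open import Data.Nat using (ℕ; zero; suc; _+_; _*_; _∸_; _^_; _≤_; _<_)
open import Data.Bool using (Bool; true; false; _∧_; _∨_; not; _xor_; if_then_else_)
import Data.Bool.Properties as BoolP
open import Data.Vec using (Vec; []; _∷_; zipWith; replicate; foldr)
import Data.Vec.Properties as VecP
open import Data.List using (List; []; _∷_; length; filterᵇ; map; concatMap; upTo)
open import Data.Bool.ListAction using (and)
open import Data.Product using (Σ; ∃; _×_; _,_)
open import Data.Product.Properties using (≡-dec)
open import Data.Sum using (_⊎_)
open import Relation.Binary.PropositionalEquality using (_≡_; _≢_)
open import Relation.Nullary using (¬_)
open import Relation.Nullary.Decidable using (isYes)

-- Generic graph notions.  A finite graph is given by a vertex type V,
-- a list `verts` enumerating all vertices (each exactly once), and a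
-- Boolean adjacency relation `adj`.

module GraphNotions {V : Set} (verts : List V) (adj : V → V → Bool) where

  order : ℕ
  order = length verts

  deg : V → ℕ
  deg x = length (filterᵇ (λ z → adj x z) verts)

  common : V → V → ℕ
  common x y = length (filterᵇ (λ z → adj x z ∧ adj y z) verts)

  IsRegular : ℕ → Set
  IsRegular k = ∀ x → deg x ≡ k

  HasEdge : Set
  HasEdge = ∃ λ x → ∃ λ y → adj x y ≡ true

  IsComplete : Set
  IsComplete = ∀ x y → x ≢ y → adj x y ≡ true

  IsEdgeRegular : ℕ → ℕ → ℕ → Set
  IsEdgeRegular v k l =
    order ≡ v × HasEdge × IsRegular k ×
    (∀ x y → adj x y ≡ true → common x y ≡ l)

  IsEdgeRegularGraph : Set
  IsEdgeRegularGraph = ∃ λ v → ∃ λ k → ∃ λ l → IsEdgeRegular v k l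

  IsStronglyRegular : Set
  IsStronglyRegular =
    IsEdgeRegularGraph × ¬ IsComplete ×
    (∃ λ μ → ∀ x y → x ≢ y → adj x y ≡ false → common x y ≡ μ)

  card : (V → Bool) → ℕ
  card S = length (filterᵇ S verts)

  IsClique : (V → Bool) → Set
  IsClique S = ∀ x y → S x ≡ true → S y ≡ true → x ≢ y → adj x y ≡ true

  IsRegularClique : ℕ → (V → Bool) → Set
  IsRegularClique m S =
    IsClique S × 0 < m ×
    (∀ x → S x ≡ false → length (filterᵇ (λ s → S s ∧ adj x s) verts) ≡ m)

  HasRegularClique : Set
  HasRegularClique = ∃ λ m → ∃ λ S → IsRegularClique m S

  IsStrictlyNeumaier : Set
  IsStrictlyNeumaier =
    ¬ IsComplete × IsEdgeRegularGraph × HasRegularClique × ¬ IsStronglyRegular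

-- 2 × e matrices over 𝔽₂ (Bool, with xor as addition, ∧ as product):
-- a pair (row1 , row2).

Row : ℕ → Set
Row e = Vec Bool e

Mat : ℕ → Set
Mat e = Row e × Row e

allRows : (e : ℕ) → List (Row e)
allRows zero = [] ∷ []
allRows (suc e) = concatMap (λ r → (false ∷ r) ∷ (true ∷ r) ∷ []) (allRows e)

allMats : (e : ℕ) → List (Mat e)
allMats e = concatMap (λ r₁ → map (λ r₂ → (r₁ , r₂)) (allRows e)) (allRows e)

_≟M_ : {e : ℕ} (x y : Mat e) → Relation.Nullary.Dec (x ≡ y)
_≟M_ = ≡-dec (VecP.≡-dec BoolP._≟_) (VecP.≡-dec BoolP._≟_)

_⊕_ : {e : ℕ} → Mat e → Mat e → Mat e
(a₁ , a₂) ⊕ (b₁ , b₂) = zipWith _xor_ a₁ b₁ , zipWith _xor_ a₂ b₂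

Q : {e : ℕ} → Mat e → Bool
Q (r₁ , r₂) = foldr (λ _ → Bool) _xor_ false (zipWith _∧_ r₁ r₂)

adjVO : {e : ℕ} → Mat e → Mat e → Bool
adjVO x y = not (isYes (x ≟M y)) ∧ not (Q (x ⊕ y))

-- 1-indexed entry of a row (false outside 1..e)
entry : {e : ℕ} → Row e → ℕ → Bool
entry [] j = false
entry (b ∷ r) zero = false
entry (b ∷ r) (suc zero) = b
entry (b ∷ r) (suc (suc j)) = entry r (suc j)

zeroRow : (e : ℕ) → Row e
zeroRow e = replicate e false

unitLast : (e : ℕ) → Row e
unitLast zero = []
unitLast (suc zero) = true ∷ []
unitLast (suc (suc e)) = false ∷ unitLast (suc e)

isZeroRow : {e : ℕ} → Row e → Bool
isZeroRow {e} r = isYes (VecP.≡-dec BoolP._≟_ r (zeroRow e))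

vMat : (e : ℕ) → Mat e
vMat e = zeroRow e , unitLast e

W₁ : {e : ℕ} → Mat e → Bool
W₁ (r₁ , r₂) = isZeroRow r₂

-- membership in v + W₁  (x ∈ v + W₁  iff  x - v ∈ W₁)
vW₁ : {e : ℕ} → Mat e → Bool
vW₁ {e} x = W₁ (x ⊕ vMat e)

V₁ : {e : ℕ} → Mat e → Bool
V₁ {e} x = W₁ x ∧ entry (Data.Product.proj₁ x) e

V₂ : {e : ℕ} → Mat e → Bool
V₂ {e} x = vW₁ x ∧ not (entry (Data.Product.proj₁ x) e)

Cset : {e : ℕ} → Mat e → Bool
Cset {e} (r₁ , r₂) =
  not (entry r₁ e) ∧ entry r₂ (e ∸ 1) ∧
  and (map (λ i → not (entry r₂ (suc i))) (upTo (e ∸ 2)))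

switch : {V : Set} → (V → Bool) → (V → Bool) → (V → V → Bool) → V → V → Bool
switch S T adj x y =
  if (S x ∧ T y) ∨ (T x ∧ S y) then not (adj x y) else adj x y

adjΓe2 : {e : ℕ} → Mat e → Mat e → Bool
adjΓe2 = switch (λ x → V₁ x ∨ V₂ x) Cset (switch W₁ vW₁ adjVO)

module Submission where

-- Write e = m + 2 and split a 2 × e matrix x as a ++ᴹ s, a front a of m columns and a tail s of
-- two. The sets W₁, v + W₁, V₁ ∪ V₂ and C only see s and whether the second row of a vanishes, and
-- Q is additive across the split; hence whether a ++ᴹ s and b ++ᴹ t are adjacent in Γ_{e,2} is
-- determined by the two tails, the two vanishing flags and Q (a ⊕ b). Every count in the theorem
-- is thus a sum over the sixteen tails of numbers of fronts a of prescribed type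
-- (Q (ax ⊕ a), Q (ay ⊕ a), second row of a zero) with respect to the fronts ax, ay of the vertices
-- involved. Adding a column transforms these numbers by a fixed linear recurrence; four times each
-- of them is a quadratic polynomial in 2 ^ m whose coefficients depend only on a six-bit invariant
-- of (ax, ay), and the table of these polynomials is certified by checking the recurrence on it.
-- The theorem then reduces to finite computations over invariants and pairs of tails.

open import Defs
open import Data.Nat using (ℕ; zero; suc; _+_; _*_; _∸_; _^_; _≤_; _<_; z≤n; s≤s)
import Data.Nat.Properties as ℕ
open import Data.Nat.Tactic.RingSolver using (solve-∀)
open import Data.Bool using (Bool; true; false; _∧_; _∨_; not; _xor_; if_then_else_)
open import Data.Bool.Properties using (xor-same; xor-comm; xor-assoc; xor-identityʳ; ∧-comm; ∨-comm; ∧-identityʳ; ∧-zeroʳ)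
open import Data.Bool.ListAction using (and)
open import Data.Product using (Σ; ∃; _×_; _,_; proj₁; proj₂)
open import Data.Sum using (_⊎_; inj₁; inj₂)
open import Data.Vec using (Vec; []; _∷_; zipWith)
open import Data.Vec.Properties using (zipWith-comm; zipWith-identityʳ)
open import Data.List using (List; []; _∷_; length; filterᵇ; map; concatMap; _++_; applyUpTo)
open import Data.List.Properties using (map-applyUpTo)
open import Data.Integer using (ℤ; +_; -_) renaming (_+_ to _+ℤ_; _*_ to _*ℤ_)
import Data.Integer.Properties as ℤ
open import Data.Integer.Tactic.RingSolver using () renaming (solve-∀ to solve-∀ℤ)
open import Relation.Binary.PropositionalEquality
  using (_≡_; _≢_; refl; sym; trans; cong; cong₂; subst; module ≡-Reasoning)
open import Relation.Nullary using (Dec; yes; no; ¬_)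
open import Relation.Nullary.Decidable using (isYes)
open import Data.Empty using (⊥-elim)

𝟙 : Bool → ℕ
𝟙 true  = 1
𝟙 false = 0

∑ : {A : Set} → List A → (A → ℕ) → ℕ
∑ []       f = 0
∑ (x ∷ xs) f = f x + ∑ xs f

syntax ∑ xs (λ x → e) = ∑[ x ← xs ] e

module _ {A : Set} where

  length-filterᵇ : ∀ (P : A → Bool) xs → length (filterᵇ P xs) ≡ ∑[ x ← xs ] 𝟙 (P x)
  length-filterᵇ P [] = refl
  length-filterᵇ P (x ∷ xs) with P x
  ... | true  = cong suc (length-filterᵇ P xs)
  ... | false = length-filterᵇ P xs

  length≡∑1 : ∀ (xs : List A) → length xs ≡ ∑[ x ← xs ] 1
  length≡∑1 []       = refl
  length≡∑1 (x ∷ xs) = cong suc (length≡∑1 xs)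

  ∑-cong : ∀ {f g : A → ℕ} xs → (∀ x → f x ≡ g x) → ∑ xs f ≡ ∑ xs g
  ∑-cong []       f≗g = refl
  ∑-cong (x ∷ xs) f≗g = cong₂ _+_ (f≗g x) (∑-cong xs f≗g)

  ∑-zero : ∀ (xs : List A) → ∑[ x ← xs ] 0 ≡ 0
  ∑-zero []       = refl
  ∑-zero (x ∷ xs) = ∑-zero xs

  ∑-distrib-+ : ∀ (f g : A → ℕ) xs → ∑[ x ← xs ] (f x + g x) ≡ ∑ xs f + ∑ xs g
  ∑-distrib-+ f g []       = refl
  ∑-distrib-+ f g (x ∷ xs) = trans (cong (_+_ (f x + g x)) (∑-distrib-+ f g xs))
                                   (interchange (f x) (g x) (∑ xs f) (∑ xs g))
    where
    interchange : ∀ a b c d → (a + b) + (c + d) ≡ (a + c) + (b + d)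
    interchange = solve-∀

  ∑-*ˡ : ∀ k (f : A → ℕ) xs → ∑[ x ← xs ] (k * f x) ≡ k * ∑ xs f
  ∑-*ˡ k f []       = sym (ℕ.*-zeroʳ k)
  ∑-*ˡ k f (x ∷ xs) = trans (cong (_+_ (k * f x)) (∑-*ˡ k f xs)) (sym (ℕ.*-distribˡ-+ k (f x) (∑ xs f)))

  ∑-*ʳ : ∀ k (f : A → ℕ) xs → ∑[ x ← xs ] (f x * k) ≡ ∑ xs f * k
  ∑-*ʳ k f xs = trans (∑-cong xs (λ x → ℕ.*-comm (f x) k)) (trans (∑-*ˡ k f xs) (ℕ.*-comm k (∑ xs f)))

  ∑-++ : ∀ (f : A → ℕ) xs ys → ∑ (xs ++ ys) f ≡ ∑ xs f + ∑ ys f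
  ∑-++ f []       ys = refl
  ∑-++ f (x ∷ xs) ys = trans (cong (_+_ (f x)) (∑-++ f xs ys)) (sym (ℕ.+-assoc (f x) (∑ xs f) (∑ ys f)))

module _ {A B : Set} where

  ∑-map : ∀ (f : B → ℕ) (g : A → B) xs → ∑ (map g xs) f ≡ ∑[ x ← xs ] f (g x)
  ∑-map f g []       = refl
  ∑-map f g (x ∷ xs) = cong (_+_ (f (g x))) (∑-map f g xs)

  ∑-concatMap : ∀ (f : B → ℕ) (g : A → List B) xs →
    ∑ (concatMap g xs) f ≡ ∑[ x ← xs ] ∑ (g x) f
  ∑-concatMap f g []       = refl
  ∑-concatMap f g (x ∷ xs) = trans (∑-++ f (g x) (concatMap g xs)) (cong (_+_ (∑ (g x) f)) (∑-concatMap f g xs))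

  ∑-comm : ∀ (f : A → B → ℕ) xs ys → ∑[ x ← xs ] ∑[ y ← ys ] f x y ≡ ∑[ y ← ys ] ∑[ x ← xs ] f x y
  ∑-comm f []       ys = sym (∑-zero ys)
  ∑-comm f (x ∷ xs) ys = trans (cong (_+_ (∑ ys (f x))) (∑-comm f xs ys))
                               (sym (∑-distrib-+ (f x) (λ y → ∑[ x ← xs ] f x y) ys))

  ∑-fibres : ∀ (τ : A → B) (_≈_ : B → B → Bool) (ts : List B) →
    (∀ (g : B → ℕ) u → ∑[ t ← ts ] (𝟙 (u ≈ t) * g t) ≡ g u) →
    ∀ (g : B → ℕ) xs → ∑[ x ← xs ] g (τ x) ≡ ∑[ t ← ts ] (g t * ∑[ x ← xs ] 𝟙 (τ x ≈ t))
  ∑-fibres τ _≈_ ts δ g xs = begin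
    ∑[ x ← xs ] g (τ x)                              ≡⟨ ∑-cong xs (λ x → sym (δ g (τ x))) ⟩
    ∑[ x ← xs ] ∑[ t ← ts ] (𝟙 (τ x ≈ t) * g t)      ≡⟨ ∑-comm (λ x t → 𝟙 (τ x ≈ t) * g t) xs ts ⟩
    ∑[ t ← ts ] ∑[ x ← xs ] (𝟙 (τ x ≈ t) * g t)      ≡⟨ ∑-cong ts (λ t → ∑-*ʳ (g t) (λ x → 𝟙 (τ x ≈ t)) xs) ⟩
    ∑[ t ← ts ] (∑[ x ← xs ] 𝟙 (τ x ≈ t) * g t)      ≡⟨ ∑-cong ts (λ t → ℕ.*-comm _ (g t)) ⟩
    ∑[ t ← ts ] (g t * ∑[ x ← xs ] 𝟙 (τ x ≈ t))      ∎
    where open ≡-Reasoning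

∧-true : ∀ {a b : Bool} → a ∧ b ≡ true → a ≡ true × b ≡ true
∧-true {true} {true} _ = refl , refl

∨-resolve : ∀ {a b : Bool} → a ∨ b ≡ true → a ≡ false → b ≡ true
∨-resolve {false} b refl = b

true≢false : true ≢ false
true≢false ()

record Searchable (A : Set) : Set where
  field
    every       : (A → Bool) → Bool
    every-sound : ∀ P → every P ≡ true → ∀ a → P a ≡ true
open Searchable public

Bool-searchable : Searchable Bool
Bool-searchable .every P = P false ∧ P true
Bool-searchable .every-sound P ok false = proj₁ (∧-true ok)
Bool-searchable .every-sound P ok true  = proj₂ (∧-true {P false} ok)

×-searchable : ∀ {A B} → Searchable A → Searchable B → Searchable (A × B)
×-searchable SA SB .every P = every SA (λ a → every SB (λ b → P (a , b)))
×-searchable SA SB .every-sound P ok (a , b) =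
  every-sound SB (λ b → P (a , b)) (every-sound SA (λ a → every SB (λ b → P (a , b))) ok a) b

Vec-searchable : ∀ {A} → Searchable A → ∀ n → Searchable (Vec A n)
Vec-searchable SA zero    .every P = P []
Vec-searchable SA zero    .every-sound P ok [] = ok
Vec-searchable SA (suc n) .every P = every SA (λ a → every (Vec-searchable SA n) (λ v → P (a ∷ v)))
Vec-searchable SA (suc n) .every-sound P ok (a ∷ v) =
  every-sound (Vec-searchable SA n) (λ v → P (a ∷ v))
    (every-sound SA (λ a → every (Vec-searchable SA n) (λ v → P (a ∷ v))) ok a) v

retract-searchable : ∀ {A B} (f : A → B) (g : B → A) → (∀ b → f (g b) ≡ b) → Searchable A → Searchable B
retract-searchable f g fg SA .every P = every SA (λ a → P (f a))
retract-searchable f g fg SA .every-sound P ok b = subst (λ b → P b ≡ true) (fg b) (every-sound SA (λ a → P (f a)) ok (g b))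

-- Enumerating matrices and splitting off the last two columns

∑ᴹ : (k : ℕ) → (Mat k → ℕ) → ℕ
∑ᴹ k f = ∑ (allMats k) f

#ᴹ : ∀ {k} → (Mat k → Bool) → ℕ
#ᴹ {k} P = ∑ᴹ k (λ z → 𝟙 (P z))

Column : Set
Column = Bool × Bool

columns : List Column
columns = (false , false) ∷ (false , true) ∷ (true , false) ∷ (true , true) ∷ []

_∷ᴹ_ : ∀ {k} → Column → Mat k → Mat (suc k)
(c₁ , c₂) ∷ᴹ (r₁ , r₂) = c₁ ∷ r₁ , c₂ ∷ r₂

∑ᴹ-rows : ∀ k (f : Mat k → ℕ) → ∑ᴹ k f ≡ ∑[ r₁ ← allRows k ] ∑[ r₂ ← allRows k ] f (r₁ , r₂)
∑ᴹ-rows k f = trans (∑-concatMap f (λ r₁ → map (r₁ ,_) (allRows k)) (allRows k))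
                    (∑-cong (allRows k) (λ r₁ → ∑-map f (r₁ ,_) (allRows k)))

∑-allRows-suc : ∀ k (f : Row (suc k) → ℕ) →
  ∑ (allRows (suc k)) f ≡ ∑[ r ← allRows k ] (f (false ∷ r) + f (true ∷ r))
∑-allRows-suc k f = trans (∑-concatMap f (λ r → (false ∷ r) ∷ (true ∷ r) ∷ []) (allRows k))
  (∑-cong (allRows k) (λ r → cong (_+_ (f (false ∷ r))) (ℕ.+-identityʳ (f (true ∷ r)))))

∑ᴹ-suc : ∀ k (f : Mat (suc k) → ℕ) → ∑ᴹ (suc k) f ≡ ∑ᴹ k (λ a → ∑[ c ← columns ] f (c ∷ᴹ a))
∑ᴹ-suc k f = begin
  ∑ᴹ (suc k) f
    ≡⟨ ∑ᴹ-rows (suc k) f ⟩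
  ∑[ r₁ ← allRows (suc k) ] ∑[ r₂ ← allRows (suc k) ] f (r₁ , r₂)
    ≡⟨ ∑-allRows-suc k _ ⟩
  ∑[ r₁ ← allRows k ] (∑[ r₂ ← allRows (suc k) ] f (false ∷ r₁ , r₂)
                     + ∑[ r₂ ← allRows (suc k) ] f (true ∷ r₁ , r₂))
    ≡⟨ ∑-cong (allRows k) (λ r₁ → cong₂ _+_ (∑-allRows-suc k _) (∑-allRows-suc k _)) ⟩
  ∑[ r₁ ← allRows k ] (∑[ r₂ ← allRows k ] (f (false ∷ r₁ , false ∷ r₂) + f (false ∷ r₁ , true ∷ r₂))
                     + ∑[ r₂ ← allRows k ] (f (true ∷ r₁ , false ∷ r₂) + f (true ∷ r₁ , true ∷ r₂)))
    ≡⟨ ∑-cong (allRows k) (λ r₁ → sym (∑-distrib-+ _ _ (allRows k))) ⟩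
  ∑[ r₁ ← allRows k ] ∑[ r₂ ← allRows k ] ((f (false ∷ r₁ , false ∷ r₂) + f (false ∷ r₁ , true ∷ r₂))
                                          + (f (true ∷ r₁ , false ∷ r₂) + f (true ∷ r₁ , true ∷ r₂)))
    ≡⟨ ∑-cong (allRows k) (λ r₁ → ∑-cong (allRows k) (regroup r₁)) ⟩
  ∑[ r₁ ← allRows k ] ∑[ r₂ ← allRows k ] ∑[ c ← columns ] f (c ∷ᴹ (r₁ , r₂))
    ≡⟨ sym (∑ᴹ-rows k _) ⟩
  ∑ᴹ k (λ a → ∑[ c ← columns ] f (c ∷ᴹ a)) ∎
  where
  open ≡-Reasoning
  regroup : ∀ r₁ r₂ → (f (false ∷ r₁ , false ∷ r₂) + f (false ∷ r₁ , true ∷ r₂))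
                     + (f (true ∷ r₁ , false ∷ r₂) + f (true ∷ r₁ , true ∷ r₂))
                   ≡ ∑[ c ← columns ] f (c ∷ᴹ (r₁ , r₂))
  regroup r₁ r₂ = reassoc (f (false ∷ r₁ , false ∷ r₂)) (f (false ∷ r₁ , true ∷ r₂))
                               (f (true ∷ r₁ , false ∷ r₂)) (f (true ∷ r₁ , true ∷ r₂))
    where
    reassoc : ∀ a b c d → (a + b) + (c + d) ≡ a + (b + (c + (d + 0)))
    reassoc = solve-∀

_++ᴿ_ : ∀ {m} → Row m → Row 2 → Row (suc (suc m))
[]      ++ᴿ s = s
(b ∷ r) ++ᴿ s = b ∷ (r ++ᴿ s)

_++ᴹ_ : ∀ {m} → Mat m → Mat 2 → Mat (suc (suc m))
(a₁ , a₂) ++ᴹ (s₁ , s₂) = a₁ ++ᴿ s₁ , a₂ ++ᴿ s₂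

∑ᴹ-++ᴹ : ∀ m (f : Mat (suc (suc m)) → ℕ) →
  ∑ᴹ (suc (suc m)) f ≡ ∑[ s ← allMats 2 ] ∑ᴹ m (λ a → f (a ++ᴹ s))
∑ᴹ-++ᴹ zero    f = ∑-cong (allMats 2) (λ s → sym (ℕ.+-identityʳ (f s)))
∑ᴹ-++ᴹ (suc m) f = trans (∑ᴹ-suc (suc (suc m)) f)
  (trans (∑ᴹ-++ᴹ m _) (∑-cong (allMats 2) (λ s → sym (∑ᴹ-suc m (λ a → f (a ++ᴹ s))))))

initᴿ : ∀ {m} → Row (suc (suc m)) → Row m
initᴿ {zero}  r       = []
initᴿ {suc m} (b ∷ r) = b ∷ initᴿ r

lastᴿ : ∀ {m} → Row (suc (suc m)) → Row 2
lastᴿ {zero}  r       = r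
lastᴿ {suc m} (b ∷ r) = lastᴿ r

initᴿ++lastᴿ : ∀ {m} (r : Row (suc (suc m))) → initᴿ r ++ᴿ lastᴿ r ≡ r
initᴿ++lastᴿ {zero}  r       = refl
initᴿ++lastᴿ {suc m} (b ∷ r) = cong (b ∷_) (initᴿ++lastᴿ r)

lastᴿ-++ᴿ : ∀ {m} (a : Row m) (s : Row 2) → lastᴿ (a ++ᴿ s) ≡ s
lastᴿ-++ᴿ []      s = refl
lastᴿ-++ᴿ (b ∷ a) s = lastᴿ-++ᴿ a s

initᴹ : ∀ {m} → Mat (suc (suc m)) → Mat m
initᴹ (r₁ , r₂) = initᴿ r₁ , initᴿ r₂

lastᴹ : ∀ {m} → Mat (suc (suc m)) → Mat 2
lastᴹ (r₁ , r₂) = lastᴿ r₁ , lastᴿ r₂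

initᴹ++lastᴹ : ∀ {m} (x : Mat (suc (suc m))) → initᴹ x ++ᴹ lastᴹ x ≡ x
initᴹ++lastᴹ (r₁ , r₂) = cong₂ _,_ (initᴿ++lastᴿ r₁) (initᴿ++lastᴿ r₂)

++ᴹ-elim : ∀ {m} (P : Mat (suc (suc m)) → Set) → (∀ a s → P (a ++ᴹ s)) → ∀ x → P x
++ᴹ-elim P h x = subst P (initᴹ++lastᴹ x) (h (initᴹ x) (lastᴹ x))

lastᴹ-++ᴹ : ∀ {m} (a : Mat m) (s : Mat 2) → lastᴹ (a ++ᴹ s) ≡ s
lastᴹ-++ᴹ (a₁ , a₂) (s₁ , s₂) = cong₂ _,_ (lastᴿ-++ᴿ a₁ s₁) (lastᴿ-++ᴿ a₂ s₂)

-- Boolean tests that, unlike the decision procedures of Defs, compute on open terms.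
isZero : ∀ {m} → Row m → Bool
isZero []      = true
isZero (b ∷ r) = not b ∧ isZero r

isZero-sound : ∀ {m} (r : Row m) → isZero r ≡ true → r ≡ zeroRow m
isZero-sound []          _ = refl
isZero-sound (false ∷ r) z = cong (false ∷_) (isZero-sound r z)

isZero-zeroRow : ∀ m → isZero (zeroRow m) ≡ true
isZero-zeroRow zero    = refl
isZero-zeroRow (suc m) = isZero-zeroRow m

isYes≡isZero : ∀ {m} (r : Row m) (d : Dec (r ≡ zeroRow m)) → isYes d ≡ isZero r
isYes≡isZero {m} r (yes refl) = sym (isZero-zeroRow m)
isYes≡isZero r (no r≢0) with isZero r in z
... | true  = ⊥-elim (r≢0 (isZero-sound r z))
... | false = refl

isZeroRow≡isZero : ∀ {m} (r : Row m) → isZeroRow r ≡ isZero r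
isZeroRow≡isZero r = isYes≡isZero r _

isZero₂ : ∀ {m} → Mat m → Bool
isZero₂ a = isZero (proj₂ a)

-- Adjacency in Γ_{e,2} through the last two columns

_==ᴮ_ : Bool → Bool → Bool
a ==ᴮ b = not (a xor b)

==ᴮ-sound : ∀ a b → a ==ᴮ b ≡ true → a ≡ b
==ᴮ-sound false false _ = refl
==ᴮ-sound true  true  _ = refl

_==ᴿ_ : ∀ {m} → Row m → Row m → Bool
[]      ==ᴿ []      = true
(a ∷ r) ==ᴿ (b ∷ s) = (a ==ᴮ b) ∧ (r ==ᴿ s)

_==ᴹ_ : ∀ {m} → Mat m → Mat m → Bool
(r₁ , r₂) ==ᴹ (s₁ , s₂) = (r₁ ==ᴿ s₁) ∧ (r₂ ==ᴿ s₂)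

==ᴿ-sound : ∀ {m} (r s : Row m) → r ==ᴿ s ≡ true → r ≡ s
==ᴿ-sound []          []          _  = refl
==ᴿ-sound (false ∷ r) (false ∷ s) eq = cong (false ∷_) (==ᴿ-sound r s eq)
==ᴿ-sound (true ∷ r)  (true ∷ s)  eq = cong (true ∷_) (==ᴿ-sound r s eq)

==ᴿ-refl : ∀ {m} (r : Row m) → r ==ᴿ r ≡ true
==ᴿ-refl []          = refl
==ᴿ-refl (false ∷ r) = ==ᴿ-refl r
==ᴿ-refl (true ∷ r)  = ==ᴿ-refl r

==ᴹ-sound : ∀ {m} (x y : Mat m) → x ==ᴹ y ≡ true → x ≡ y
==ᴹ-sound (r₁ , r₂) (s₁ , s₂) eq with ∧-true {r₁ ==ᴿ s₁} eq
... | eq₁ , eq₂ = cong₂ _,_ (==ᴿ-sound r₁ s₁ eq₁) (==ᴿ-sound r₂ s₂ eq₂)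

==ᴹ-refl : ∀ {m} (x : Mat m) → x ==ᴹ x ≡ true
==ᴹ-refl (r₁ , r₂) rewrite ==ᴿ-refl r₁ = ==ᴿ-refl r₂

==ᴹ-complete : ∀ {m} {x y : Mat m} → x ≢ y → x ==ᴹ y ≡ false
==ᴹ-complete {x = x} {y} x≢y with x ==ᴹ y in eq
... | true  = ⊥-elim (x≢y (==ᴹ-sound x y eq))
... | false = refl

isYes-≟M : ∀ {m} (x y : Mat m) → isYes (x ≟M y) ≡ x ==ᴹ y
isYes-≟M x y with x ≟M y
... | yes refl = sym (==ᴹ-refl x)
... | no x≢y   = sym (==ᴹ-complete x≢y)

zeroM : ∀ m → Mat m
zeroM m = zeroRow m , zeroRow m

⊕-comm : ∀ {m} (x y : Mat m) → x ⊕ y ≡ y ⊕ x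
⊕-comm (x₁ , x₂) (y₁ , y₂) = cong₂ _,_ (zipWith-comm xor-comm x₁ y₁) (zipWith-comm xor-comm x₂ y₂)

⊕-identityʳ : ∀ {m} (x : Mat m) → x ⊕ zeroM m ≡ x
⊕-identityʳ (x₁ , x₂) = cong₂ _,_ (zipWith-identityʳ xor-identityʳ x₁) (zipWith-identityʳ xor-identityʳ x₂)

xor-selfᴿ : ∀ {m} (r : Row m) → zipWith _xor_ r r ≡ zeroRow m
xor-selfᴿ []      = refl
xor-selfᴿ (b ∷ r) = cong₂ _∷_ (xor-same b) (xor-selfᴿ r)

⊕-self : ∀ {m} (x : Mat m) → x ⊕ x ≡ zeroM m
⊕-self (x₁ , x₂) = cong₂ _,_ (xor-selfᴿ x₁) (xor-selfᴿ x₂)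

Q-zeroRow₂ : ∀ {m} (r : Row m) → Q (r , zeroRow m) ≡ false
Q-zeroRow₂ []      = refl
Q-zeroRow₂ (false ∷ r) = Q-zeroRow₂ r
Q-zeroRow₂ (true ∷ r)  = Q-zeroRow₂ r

Q-self : ∀ {m} (x : Mat m) → Q (x ⊕ x) ≡ false
Q-self {m} x = trans (cong Q (⊕-self x)) (Q-zeroRow₂ (zeroRow m))

Q-⊕-isZero₂ : ∀ {m} (a b : Mat m) → isZero₂ a ≡ true → isZero₂ b ≡ true → Q (a ⊕ b) ≡ false
Q-⊕-isZero₂ {m} (a₁ , a₂) (b₁ , b₂) za zb
  rewrite isZero-sound a₂ za | isZero-sound b₂ zb | xor-selfᴿ (zeroRow m) = Q-zeroRow₂ (zipWith _xor_ a₁ b₁)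

Q-++ᴹ : ∀ {m} (a : Mat m) (s : Mat 2) → Q (a ++ᴹ s) ≡ Q a xor Q s
Q-++ᴹ ([] , [])             (s₁ , s₂) = refl
Q-++ᴹ (b₁ ∷ a₁ , b₂ ∷ a₂) s =
  trans (cong ((b₁ ∧ b₂) xor_) (Q-++ᴹ (a₁ , a₂) s)) (sym (xor-assoc (b₁ ∧ b₂) (Q (a₁ , a₂)) (Q s)))

⊕-++ᴹ : ∀ {m} (a b : Mat m) (s t : Mat 2) → (a ++ᴹ s) ⊕ (b ++ᴹ t) ≡ (a ⊕ b) ++ᴹ (s ⊕ t)
⊕-++ᴹ (a₁ , a₂) (b₁ , b₂) (s₁ , s₂) (t₁ , t₂) = cong₂ _,_ (xorᴿ a₁ b₁) (xorᴿ a₂ b₂)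
  where
  xorᴿ : ∀ {m} (a b : Row m) {s t : Row 2} →
    zipWith _xor_ (a ++ᴿ s) (b ++ᴿ t) ≡ zipWith _xor_ a b ++ᴿ zipWith _xor_ s t
  xorᴿ []      []      = refl
  xorᴿ (x ∷ a) (y ∷ b) = cong ((x xor y) ∷_) (xorᴿ a b)

isZero-++ᴿ : ∀ {m} (a : Row m) (s : Row 2) → isZero (a ++ᴿ s) ≡ isZero a ∧ isZero s
isZero-++ᴿ []          s = refl
isZero-++ᴿ (false ∷ a) s = isZero-++ᴿ a s
isZero-++ᴿ (true ∷ a)  s = refl

vMat-++ᴹ : ∀ m → vMat (suc (suc m)) ≡ zeroM m ++ᴹ vMat 2
vMat-++ᴹ m = cong₂ _,_ (zeros m) (unit m)
  where
  zeros : ∀ m → zeroRow (suc (suc m)) ≡ zeroRow m ++ᴿ zeroRow 2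
  zeros zero    = refl
  zeros (suc m) = cong (false ∷_) (zeros m)
  unit : ∀ m → unitLast (suc (suc m)) ≡ zeroRow m ++ᴿ unitLast 2
  unit zero    = refl
  unit (suc m) = cong (false ∷_) (unit m)

entry-++ᴿ-last : ∀ {m} (a : Row m) (s : Row 2) → entry (a ++ᴿ s) (suc (suc m)) ≡ entry s 2
entry-++ᴿ-last []      s = refl
entry-++ᴿ-last (b ∷ a) s = entry-++ᴿ-last a s

entry-++ᴿ-penultimate : ∀ {m} (a : Row m) (s : Row 2) → entry (a ++ᴿ s) (suc m) ≡ entry s 1
entry-++ᴿ-penultimate []      s = refl
entry-++ᴿ-penultimate (b ∷ a) s = entry-++ᴿ-penultimate a s

and-entries-++ᴿ : ∀ {m} (a : Row m) (s : Row 2) →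
  and (applyUpTo (λ i → not (entry (a ++ᴿ s) (suc i))) m) ≡ isZero a
and-entries-++ᴿ []      s = refl
and-entries-++ᴿ (b ∷ a) s = cong (not b ∧_) (and-entries-++ᴿ a s)

record Profile : Set where
  constructor ⟨_,_,_,_⟩
  field
    inW₁ invW₁ inV inC : Bool
open Profile public

profile : ∀ {e} → Mat e → Profile
profile x = ⟨ W₁ x , vW₁ x , V₁ x ∨ V₂ x , Cset x ⟩

flipIf : Bool → Bool → Bool
flipIf b a = if b then not a else a

between : Bool → Bool → Bool → Bool → Bool
between s t s' t' = (s ∧ t') ∨ (t ∧ s')

adjProfile : Profile → Profile → (equal q : Bool) → Bool
adjProfile p p' equal q =
  flipIf (between (inV p) (inC p) (inV p') (inC p'))
    (flipIf (between (inW₁ p) (invW₁ p) (inW₁ p') (invW₁ p')) (not equal ∧ not q))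

tailProfile : Bool → Mat 2 → Profile
tailProfile z s = ⟨ w , vw , (w ∧ entry (proj₁ s) 2) ∨ (vw ∧ not (entry (proj₁ s) 2))
                  , not (entry (proj₁ s) 2) ∧ entry (proj₂ s) 1 ∧ z ⟩
  where
  w  = z ∧ isZero (proj₂ s)
  vw = z ∧ isZero (proj₂ (s ⊕ vMat 2))

W₁-++ᴹ : ∀ {m} (a : Mat m) (s : Mat 2) → W₁ (a ++ᴹ s) ≡ isZero₂ a ∧ isZero (proj₂ s)
W₁-++ᴹ (a₁ , a₂) (s₁ , s₂) = trans (isZeroRow≡isZero (a₂ ++ᴿ s₂)) (isZero-++ᴿ a₂ s₂)

vW₁-++ᴹ : ∀ {m} (a : Mat m) (s : Mat 2) → vW₁ (a ++ᴹ s) ≡ isZero₂ a ∧ isZero (proj₂ (s ⊕ vMat 2))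
vW₁-++ᴹ {m} a s = begin
  W₁ ((a ++ᴹ s) ⊕ vMat (suc (suc m)))      ≡⟨ cong (λ v → W₁ ((a ++ᴹ s) ⊕ v)) (vMat-++ᴹ m) ⟩
  W₁ ((a ++ᴹ s) ⊕ (zeroM m ++ᴹ vMat 2))    ≡⟨ cong W₁ (⊕-++ᴹ a (zeroM m) s (vMat 2)) ⟩
  W₁ ((a ⊕ zeroM m) ++ᴹ (s ⊕ vMat 2))      ≡⟨ cong (λ b → W₁ (b ++ᴹ (s ⊕ vMat 2))) (⊕-identityʳ a) ⟩
  W₁ (a ++ᴹ (s ⊕ vMat 2))                  ≡⟨ W₁-++ᴹ a (s ⊕ vMat 2) ⟩
  isZero₂ a ∧ isZero (proj₂ (s ⊕ vMat 2))  ∎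
  where open ≡-Reasoning

profile-++ᴹ : ∀ {m} (a : Mat m) (s : Mat 2) → profile (a ++ᴹ s) ≡ tailProfile (isZero₂ a) s
profile-++ᴹ {m} (a₁ , a₂) (s₁ , s₂)
  rewrite W₁-++ᴹ (a₁ , a₂) (s₁ , s₂) | vW₁-++ᴹ (a₁ , a₂) (s₁ , s₂)
        | entry-++ᴿ-last a₁ s₁ | entry-++ᴿ-penultimate a₂ s₂
        | map-applyUpTo (λ i → i) (λ i → not (entry (a₂ ++ᴿ s₂) (suc i))) m
        | and-entries-++ᴿ a₂ s₂ = refl

-- Γ_{e,2} with a loop added at every vertex.
adj⁺ : ∀ {e} → Mat e → Mat e → Bool
adj⁺ x y = adjProfile (profile x) (profile y) false (Q (x ⊕ y))

adjTail : Bool → Mat 2 → Bool → Mat 2 → Bool → Bool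
adjTail zx sx zy sy q = adjProfile (tailProfile zx sx) (tailProfile zy sy) false (q xor Q (sx ⊕ sy))

adj⁺-++ᴹ : ∀ {m} (a : Mat m) (s : Mat 2) (b : Mat m) (t : Mat 2) →
  adj⁺ (a ++ᴹ s) (b ++ᴹ t) ≡ adjTail (isZero₂ a) s (isZero₂ b) t (Q (a ⊕ b))
adj⁺-++ᴹ a s b t =
  trans (cong₂ (λ p p' → adjProfile p p' false (Q ((a ++ᴹ s) ⊕ (b ++ᴹ t)))) (profile-++ᴹ a s) (profile-++ᴹ b t))
        (cong (adjProfile (tailProfile (isZero₂ a) s) (tailProfile (isZero₂ b) t) false)
              (trans (cong Q (⊕-++ᴹ a b s t)) (Q-++ᴹ (a ⊕ b) (s ⊕ t))))

between-sym : ∀ s t s' t' → between s t s' t' ≡ between s' t' s t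
between-sym s t s' t' = trans (∨-comm (s ∧ t') (t ∧ s')) (cong₂ _∨_ (∧-comm t s') (∧-comm s t'))

adjProfile-sym : ∀ p p' equal q → adjProfile p p' equal q ≡ adjProfile p' p equal q
adjProfile-sym ⟨ w , vw , v , c ⟩ ⟨ w' , vw' , v' , c' ⟩ equal q
  rewrite between-sym v c v' c' | between-sym w vw w' vw' = refl

adj⁺-sym : ∀ {e} (x y : Mat e) → adj⁺ x y ≡ adj⁺ y x
adj⁺-sym x y = trans (adjProfile-sym (profile x) (profile y) false (Q (x ⊕ y)))
                     (cong (adjProfile (profile y) (profile x) false) (cong Q (⊕-comm x y)))

Disjoint : Profile → Bool
Disjoint p = not (inW₁ p ∧ invW₁ p) ∧ not (inV p ∧ inC p)

between-self : ∀ s t → not (s ∧ t) ≡ true → between s t s t ≡ false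
between-self false false _ = refl
between-self false true  _ = refl
between-self true  false _ = refl

-- Switching between disjoint sets never touches a pair {x, x}.
adjProfile-loop : ∀ p → Disjoint p ≡ true → ∀ equal q → adjProfile p p equal q ≡ not equal ∧ not q
adjProfile-loop ⟨ w , vw , v , c ⟩ disj equal q with ∧-true {not (w ∧ vw)} disj
... | w∩vw , v∩c rewrite between-self w vw w∩vw | between-self v c v∩c = refl

Mat₂-searchable : Searchable (Mat 2)
Mat₂-searchable = ×-searchable (Vec-searchable Bool-searchable 2) (Vec-searchable Bool-searchable 2)

tailProfile-disjoint : ∀ z s → Disjoint (tailProfile z s) ≡ true
tailProfile-disjoint z s =
  every-sound (×-searchable Bool-searchable Mat₂-searchable) (λ (z , s) → Disjoint (tailProfile z s)) refl (z , s)

profile-disjoint : ∀ {m} (x : Mat (suc (suc m))) → Disjoint (profile x) ≡ true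
profile-disjoint = ++ᴹ-elim (λ x → Disjoint (profile x) ≡ true)
  (λ a s → trans (cong Disjoint (profile-++ᴹ a s)) (tailProfile-disjoint (isZero₂ a) s))

adj⁺-refl : ∀ {m} (x : Mat (suc (suc m))) → adj⁺ x x ≡ true
adj⁺-refl x = trans (adjProfile-loop (profile x) (profile-disjoint x) false (Q (x ⊕ x))) (cong not (Q-self x))

adjΓe2≡adj⁺ : ∀ {m} (x y : Mat (suc (suc m))) → adjΓe2 x y ≡ not (x ==ᴹ y) ∧ adj⁺ x y
adjΓe2≡adj⁺ x y rewrite isYes-≟M x y with x ==ᴹ y in eq
... | false = refl
... | true with ==ᴹ-sound x y eq
...   | refl = adjProfile-loop (profile x) (profile-disjoint x) true (Q (x ⊕ x))

-- Counting fronts by type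

Type : Set
Type = Bool × Bool × Bool

typeOf : ∀ {m} → Mat m → Mat m → Mat m → Type
typeOf ax ay a = Q (ax ⊕ a) , Q (ay ⊕ a) , isZero₂ a

types : List Type
types = (false , false , false) ∷ (false , false , true) ∷ (false , true , false) ∷ (false , true , true)
      ∷ (true , false , false) ∷ (true , false , true) ∷ (true , true , false) ∷ (true , true , true) ∷ []

Type-searchable : Searchable Type
Type-searchable = ×-searchable Bool-searchable (×-searchable Bool-searchable Bool-searchable)

_==ᵀ_ : Type → Type → Bool
(α , β , γ) ==ᵀ (α' , β' , γ') = (α ==ᴮ α') ∧ (β ==ᴮ β') ∧ (γ ==ᴮ γ')

+0+0 : ∀ x → x + 0 + 0 ≡ x
+0+0 x = trans (ℕ.+-identityʳ (x + 0)) (ℕ.+-identityʳ x)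

∑-types-δ : ∀ (g : Type → ℕ) u → ∑[ t ← types ] (𝟙 (u ==ᵀ t) * g t) ≡ g u
∑-types-δ g (false , false , false) = +0+0 (g _)
∑-types-δ g (false , false , true)  = +0+0 (g _)
∑-types-δ g (false , true , false)  = +0+0 (g _)
∑-types-δ g (false , true , true)   = +0+0 (g _)
∑-types-δ g (true , false , false)  = +0+0 (g _)
∑-types-δ g (true , false , true)   = +0+0 (g _)
∑-types-δ g (true , true , false)   = +0+0 (g _)
∑-types-δ g (true , true , true)    = +0+0 (g _)

count : ∀ m → Mat m → Mat m → Type → ℕ
count m ax ay t = ∑ᴹ m (λ a → 𝟙 (typeOf ax ay a ==ᵀ t))

∑ᴹ-by-type : ∀ m (ax ay : Mat m) (g : Type → ℕ) →
  ∑ᴹ m (λ a → g (typeOf ax ay a)) ≡ ∑[ t ← types ] (g t * count m ax ay t)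
∑ᴹ-by-type m ax ay g = ∑-fibres (typeOf ax ay) _==ᵀ_ types ∑-types-δ g (allMats m)

extendType : Column → Column → Column → Type → Type
extendType (b₁ , b₂) (d₁ , d₂) (c₁ , c₂) (α , β , γ) =
  ((b₁ xor c₁) ∧ (b₂ xor c₂)) xor α , ((d₁ xor c₁) ∧ (d₂ xor c₂)) xor β , not c₂ ∧ γ

transitions : Column → Column → Type → Type → ℕ
transitions cx cy t t' = ∑[ c ← columns ] 𝟙 (extendType cx cy c t' ==ᵀ t)

count-∷ᴹ : ∀ m (cx cy : Column) (ax ay : Mat m) t →
  count (suc m) (cx ∷ᴹ ax) (cy ∷ᴹ ay) t ≡ ∑[ t' ← types ] (transitions cx cy t t' * count m ax ay t')
count-∷ᴹ m (b₁ , b₂) (d₁ , d₂) (ax₁ , ax₂) (ay₁ , ay₂) t =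
  trans (∑ᴹ-suc m _) (∑ᴹ-by-type m (ax₁ , ax₂) (ay₁ , ay₂) (transitions (b₁ , b₂) (d₁ , d₂) t))

record Quadratic : Set where
  no-eta-equality
  pattern
  constructor _N²+_N
  field
    lead lin : ℤ

infix 5 _N²+_N

⟦_⟧ : Quadratic → ℤ → ℤ
⟦ a N²+ b N ⟧ n = a *ℤ (n *ℤ n) +ℤ b *ℤ n

_+Q_ : Quadratic → Quadratic → Quadratic
(a N²+ b N) +Q (a' N²+ b' N) = a +ℤ a' N²+ b +ℤ b' N

_·Q_ : ℕ → Quadratic → Quadratic
k ·Q (a N²+ b N) = + k *ℤ a N²+ + k *ℤ b N

∑Q : {A : Set} → List A → (A → Quadratic) → Quadratic
∑Q []       f = + 0 N²+ + 0 N
∑Q (x ∷ xs) f = f x +Q ∑Q xs f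

syntax ∑Q xs (λ x → e) = ∑Q[ x ← xs ] e

rescale : Quadratic → Quadratic
rescale (a N²+ b N) = + 4 *ℤ a N²+ + 2 *ℤ b N

_==Q_ : Quadratic → Quadratic → Bool
(a N²+ b N) ==Q (a' N²+ b' N) = isYes (a ℤ.≟ a') ∧ isYes (b ℤ.≟ b')

==Q-sound : ∀ p p' → p ==Q p' ≡ true → p ≡ p'
==Q-sound (a N²+ b N) (a' N²+ b' N) eq with a ℤ.≟ a' | b ℤ.≟ b'
... | yes refl | yes refl = refl

⟦⟧-+Q : ∀ p p' n → ⟦ p +Q p' ⟧ n ≡ ⟦ p ⟧ n +ℤ ⟦ p' ⟧ n
⟦⟧-+Q (a N²+ b N) (a' N²+ b' N) n = lemma a b a' b' n
  where
  lemma : ∀ a b a' b' n → (a +ℤ a') *ℤ (n *ℤ n) +ℤ (b +ℤ b') *ℤ n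
                        ≡ (a *ℤ (n *ℤ n) +ℤ b *ℤ n) +ℤ (a' *ℤ (n *ℤ n) +ℤ b' *ℤ n)
  lemma = solve-∀ℤ

⟦⟧-·Q : ∀ k p n → ⟦ k ·Q p ⟧ n ≡ + k *ℤ ⟦ p ⟧ n
⟦⟧-·Q k (a N²+ b N) n = lemma (+ k) a b n
  where
  lemma : ∀ k a b n → (k *ℤ a) *ℤ (n *ℤ n) +ℤ (k *ℤ b) *ℤ n ≡ k *ℤ (a *ℤ (n *ℤ n) +ℤ b *ℤ n)
  lemma = solve-∀ℤ

⟦⟧-rescale : ∀ p n → ⟦ rescale p ⟧ n ≡ ⟦ p ⟧ (+ 2 *ℤ n)
⟦⟧-rescale (a N²+ b N) n = lemma a b n
  where
  lemma : ∀ a b n → (+ 4 *ℤ a) *ℤ (n *ℤ n) +ℤ (+ 2 *ℤ b) *ℤ n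
                  ≡ a *ℤ ((+ 2 *ℤ n) *ℤ (+ 2 *ℤ n)) +ℤ b *ℤ (+ 2 *ℤ n)
  lemma = solve-∀ℤ

⟦⟧-∑Q-· : ∀ {A : Set} (w c : A → ℕ) (f : A → Quadratic) n xs →
  (∀ x → + (4 * c x) ≡ ⟦ f x ⟧ n) →
  + (4 * ∑[ x ← xs ] (w x * c x)) ≡ ⟦ ∑Q[ x ← xs ] (w x ·Q f x) ⟧ n
⟦⟧-∑Q-· w c f n [] _ = sym (lemma n)
  where
  lemma : ∀ n → + 0 *ℤ (n *ℤ n) +ℤ + 0 *ℤ n ≡ + 0
  lemma = solve-∀ℤ
⟦⟧-∑Q-· w c f n (x ∷ xs) hyp = begin
  + (4 * (w x * c x + S))                            ≡⟨ cong +_ (lemma (w x) (c x) S) ⟩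
  + (w x * (4 * c x) + 4 * S)                        ≡⟨ ℤ.pos-+ (w x * (4 * c x)) (4 * S) ⟩
  + (w x * (4 * c x)) +ℤ + (4 * S)                   ≡⟨ cong₂ _+ℤ_ (ℤ.pos-* (w x) (4 * c x)) (⟦⟧-∑Q-· w c f n xs hyp) ⟩
  + w x *ℤ + (4 * c x) +ℤ ⟦ rest ⟧ n                 ≡⟨ cong (λ v → + w x *ℤ v +ℤ ⟦ rest ⟧ n) (hyp x) ⟩
  + w x *ℤ ⟦ f x ⟧ n +ℤ ⟦ rest ⟧ n                   ≡⟨ cong (_+ℤ ⟦ rest ⟧ n) (sym (⟦⟧-·Q (w x) (f x) n)) ⟩
  ⟦ w x ·Q f x ⟧ n +ℤ ⟦ rest ⟧ n                     ≡⟨ sym (⟦⟧-+Q (w x ·Q f x) rest n) ⟩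
  ⟦ (w x ·Q f x) +Q rest ⟧ n                         ∎
  where
  open ≡-Reasoning
  S = ∑[ x ← xs ] (w x * c x)
  rest = ∑Q[ x ← xs ] (w x ·Q f x)
  lemma : ∀ w c S → 4 * (w * c + S) ≡ w * (4 * c) + 4 * S
  lemma = solve-∀

⟦⟧-ℕ : ∀ a b n → ⟦ + a N²+ + b N ⟧ (+ n) ≡ + (a * (n * n) + b * n)
⟦⟧-ℕ a b n = sym (trans (ℤ.pos-+ (a * (n * n)) (b * n))
  (cong₂ _+ℤ_ (trans (ℤ.pos-* a (n * n)) (cong (+ a *ℤ_) (ℤ.pos-* n n))) (ℤ.pos-* b n)))

unscale : ∀ {p} a b n c → p ≡ + a N²+ + b N → + (4 * c) ≡ ⟦ p ⟧ (+ n) → 4 * c ≡ a * (n * n) + b * n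
unscale a b n c refl h = ℤ.+-injective (trans h (⟦⟧-ℕ a b n))

-- What the counts of a pair of fronts (ax , ay) depend on, computed column by column:
-- ax = ay, Q (ax ⊕ ay), equality of the second rows, vanishing of the second rows of ax and of ay,
-- and the cross term ∑ⱼ (ax ⊕ ay)₁ⱼ (ax)₂ⱼ.
record Invariant : Set where
  constructor ⟪_,_,_,_,_,_⟫
  field
    equal qDiff equal₂ zeroˣ zeroʸ cross : Bool
open Invariant public

Column²-searchable : Searchable (Column × Column)
Column²-searchable = ×-searchable C C where C = ×-searchable Bool-searchable Bool-searchable

Invariant-searchable : Searchable Invariant
Invariant-searchable = retract-searchable
  (λ (a , b , c , d , e , f) → ⟪ a , b , c , d , e , f ⟫)
  (λ s → equal s , qDiff s , equal₂ s , zeroˣ s , zeroʸ s , cross s) (λ _ → refl)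
  (×-searchable B (×-searchable B (×-searchable B (×-searchable B (×-searchable B B)))))
  where B = Bool-searchable

initial : Invariant
initial = ⟪ true , false , true , true , true , false ⟫

step : Column → Column → Invariant → Invariant
step (b₁ , b₂) (c₁ , c₂) ⟪ eq , q , eq₂ , zx , zy , cr ⟫ =
  ⟪ ((b₁ ==ᴮ c₁) ∧ (b₂ ==ᴮ c₂)) ∧ eq , ((b₁ xor c₁) ∧ (b₂ xor c₂)) xor q , (b₂ ==ᴮ c₂) ∧ eq₂
  , not b₂ ∧ zx , not c₂ ∧ zy , ((b₁ xor c₁) ∧ b₂) xor cr ⟫

invariant : ∀ {m} → Mat m → Mat m → Invariant
invariant {zero}  _ _ = initial
invariant {suc m} (b₁ ∷ ax₁ , b₂ ∷ ax₂) (c₁ ∷ ay₁ , c₂ ∷ ay₂) =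
  step (b₁ , b₂) (c₁ , c₂) (invariant (ax₁ , ax₂) (ay₁ , ay₂))

admissible : Invariant → Bool
admissible ⟪ false , _     , false , false , false , _     ⟫ = true
admissible ⟪ false , false , false , false , true  , false ⟫ = true
admissible ⟪ false , true  , false , false , true  , true  ⟫ = true
admissible ⟪ false , _     , false , true  , false , false ⟫ = true
admissible ⟪ false , false , true  , false , false , _     ⟫ = true
admissible ⟪ false , false , true  , true  , true  , false ⟫ = true
admissible ⟪ true  , false , true  , false , false , false ⟫ = true
admissible ⟪ true  , false , true  , true  , true  , false ⟫ = true
admissible _                                            = false

byType : (q₀ q₁ q₂ q₃ q₄ q₅ q₆ q₇ : Quadratic) → Type → Quadratic
byType q₀ q₁ q₂ q₃ q₄ q₅ q₆ q₇ (false , false , false) = q₀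
byType q₀ q₁ q₂ q₃ q₄ q₅ q₆ q₇ (false , false , true)  = q₁
byType q₀ q₁ q₂ q₃ q₄ q₅ q₆ q₇ (false , true , false)  = q₂
byType q₀ q₁ q₂ q₃ q₄ q₅ q₆ q₇ (false , true , true)   = q₃
byType q₀ q₁ q₂ q₃ q₄ q₅ q₆ q₇ (true , false , false)  = q₄
byType q₀ q₁ q₂ q₃ q₄ q₅ q₆ q₇ (true , false , true)   = q₅
byType q₀ q₁ q₂ q₃ q₄ q₅ q₆ q₇ (true , true , false)   = q₆
byType q₀ q₁ q₂ q₃ q₄ q₅ q₆ q₇ (true , true , true)    = q₇

-- 4 · count m ax ay t, as a polynomial in N = 2 ^ m, for admissible invariants.
-- It is found by solving the recurrence count-∷ᴹ and certified by table-closed below.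
table : Invariant → Type → Quadratic
table ⟪ false , _ , false , false , false , _ ⟫ = byType
  (+ 1 N²+ + 1 N) (+ 0 N²+ + 1 N) (+ 1 N²+ - + 1 N) (+ 0 N²+ + 1 N)
  (+ 1 N²+ - + 1 N) (+ 0 N²+ + 1 N) (+ 1 N²+ - + 3 N) (+ 0 N²+ + 1 N)
table ⟪ false , _ , false , false , true , _ ⟫ = byType
  (+ 1 N²+ + 0 N) (+ 0 N²+ + 2 N) (+ 1 N²+ + 0 N) (+ 0 N²+ + 0 N)
  (+ 1 N²+ - + 2 N) (+ 0 N²+ + 2 N) (+ 1 N²+ - + 2 N) (+ 0 N²+ + 0 N)
table ⟪ false , _ , false , true , _ , _ ⟫ = byType
  (+ 1 N²+ + 0 N) (+ 0 N²+ + 2 N) (+ 1 N²+ - + 2 N) (+ 0 N²+ + 2 N)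
  (+ 1 N²+ + 0 N) (+ 0 N²+ + 0 N) (+ 1 N²+ - + 2 N) (+ 0 N²+ + 0 N)
table ⟪ false , _ , true , false , _ , false ⟫ = byType
  (+ 1 N²+ + 0 N) (+ 0 N²+ + 2 N) (+ 1 N²+ + 0 N) (+ 0 N²+ + 0 N)
  (+ 1 N²+ + 0 N) (+ 0 N²+ + 0 N) (+ 1 N²+ - + 4 N) (+ 0 N²+ + 2 N)
table ⟪ false , _ , true , false , _ , true ⟫ = byType
  (+ 1 N²+ + 2 N) (+ 0 N²+ + 0 N) (+ 1 N²+ - + 2 N) (+ 0 N²+ + 2 N)
  (+ 1 N²+ - + 2 N) (+ 0 N²+ + 2 N) (+ 1 N²+ - + 2 N) (+ 0 N²+ + 0 N)
table ⟪ false , _ , true , true , _ , _ ⟫ = byType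
  (+ 1 N²+ - + 2 N) (+ 0 N²+ + 4 N) (+ 1 N²+ + 0 N) (+ 0 N²+ + 0 N)
  (+ 1 N²+ + 0 N) (+ 0 N²+ + 0 N) (+ 1 N²+ - + 2 N) (+ 0 N²+ + 0 N)
table ⟪ true , _ , _ , false , _ , _ ⟫ = byType
  (+ 2 N²+ + 0 N) (+ 0 N²+ + 2 N) (+ 0 N²+ + 0 N) (+ 0 N²+ + 0 N)
  (+ 0 N²+ + 0 N) (+ 0 N²+ + 0 N) (+ 2 N²+ - + 4 N) (+ 0 N²+ + 2 N)
table ⟪ true , _ , _ , true , _ , _ ⟫ = byType
  (+ 2 N²+ - + 2 N) (+ 0 N²+ + 4 N) (+ 0 N²+ + 0 N) (+ 0 N²+ + 0 N)
  (+ 0 N²+ + 0 N) (+ 0 N²+ + 0 N) (+ 2 N²+ - + 2 N) (+ 0 N²+ + 0 N)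

recurrenceHolds : Invariant → Column → Column → Type → Bool
recurrenceHolds s cx cy t =
  (∑Q[ t' ← types ] (transitions cx cy t t' ·Q table s t')) ==Q rescale (table (step cx cy s) t)

stepHolds : Invariant → Column × Column → Bool
stepHolds s (cx , cy) = admissible (step cx cy s) ∧ every Type-searchable (recurrenceHolds s cx cy)

closedAt : Invariant → Bool
closedAt s = not (admissible s) ∨ every Column²-searchable (stepHolds s)

table-closed : every Invariant-searchable closedAt ≡ true
table-closed = refl

table-step : ∀ s → admissible s ≡ true → ∀ cx cy →
  admissible (step cx cy s) ≡ true ×
  (∀ t → ∑Q[ t' ← types ] (transitions cx cy t t' ·Q table s t') ≡ rescale (table (step cx cy s) t))
table-step s adm cx cy = admissible-step , λ t → ==Q-sound _ _ (every-sound Type-searchable (recurrenceHolds s cx cy) recurrence t)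
  where
  closed = every-sound Column²-searchable (stepHolds s)
             (∨-resolve (every-sound Invariant-searchable closedAt table-closed s) (cong not adm)) (cx , cy)
  admissible-step = proj₁ (∧-true closed)
  recurrence = proj₂ (∧-true {admissible (step cx cy s)} closed)

count-table : ∀ m (ax ay : Mat m) → admissible (invariant ax ay) ≡ true ×
  (∀ t → + (4 * count m ax ay t) ≡ ⟦ table (invariant ax ay) t ⟧ (+ (2 ^ m)))
count-table zero    ([] , []) ([] , []) = refl , base
  where
  base : ∀ t → + (4 * count 0 ([] , []) ([] , []) t) ≡ ⟦ table initial t ⟧ (+ 1)
  base (false , false , false) = refl
  base (false , false , true)  = refl
  base (false , true , false)  = refl
  base (false , true , true)   = refl
  base (true , false , false)  = refl
  base (true , false , true)   = refl
  base (true , true , false)   = refl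
  base (true , true , true)    = refl
count-table (suc m) (b₁ ∷ ax₁ , b₂ ∷ ax₂) (c₁ ∷ ay₁ , c₂ ∷ ay₂) = proj₁ next , counts
  where
  cx = b₁ , b₂
  cy = c₁ , c₂
  ax = ax₁ , ax₂
  ay = ay₁ , ay₂
  s = invariant ax ay
  IH = count-table m ax ay
  next = table-step s (proj₁ IH) cx cy
  N = + (2 ^ m)
  counts : ∀ t → + (4 * count (suc m) (cx ∷ᴹ ax) (cy ∷ᴹ ay) t) ≡ ⟦ table (step cx cy s) t ⟧ (+ (2 ^ suc m))
  counts t = begin
    + (4 * count (suc m) (cx ∷ᴹ ax) (cy ∷ᴹ ay) t)
      ≡⟨ cong (λ k → + (4 * k)) (count-∷ᴹ m cx cy ax ay t) ⟩
    + (4 * ∑[ t' ← types ] (transitions cx cy t t' * count m ax ay t'))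
      ≡⟨ ⟦⟧-∑Q-· (transitions cx cy t) (count m ax ay) (table s) N types (proj₂ IH) ⟩
    ⟦ ∑Q[ t' ← types ] (transitions cx cy t t' ·Q table s t') ⟧ N
      ≡⟨ cong (λ p → ⟦ p ⟧ N) (proj₂ next t) ⟩
    ⟦ rescale (table (step cx cy s) t) ⟧ N
      ≡⟨ ⟦⟧-rescale (table (step cx cy s) t) N ⟩
    ⟦ table (step cx cy s) t ⟧ (+ 2 *ℤ N)
      ≡⟨ cong ⟦ table (step cx cy s) t ⟧ (sym (ℤ.pos-* 2 (2 ^ m))) ⟩
    ⟦ table (step cx cy s) t ⟧ (+ (2 ^ suc m)) ∎
    where open ≡-Reasoning

invariant-zeroˣ : ∀ {m} (ax ay : Mat m) → zeroˣ (invariant ax ay) ≡ isZero₂ ax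
invariant-zeroˣ {zero}  ([] , []) ([] , []) = refl
invariant-zeroˣ {suc m} (b₁ ∷ ax₁ , b₂ ∷ ax₂) (c₁ ∷ ay₁ , c₂ ∷ ay₂) =
  cong (not b₂ ∧_) (invariant-zeroˣ (ax₁ , ax₂) (ay₁ , ay₂))

invariant-zeroʸ : ∀ {m} (ax ay : Mat m) → zeroʸ (invariant ax ay) ≡ isZero₂ ay
invariant-zeroʸ {zero}  ([] , []) ([] , []) = refl
invariant-zeroʸ {suc m} (b₁ ∷ ax₁ , b₂ ∷ ax₂) (c₁ ∷ ay₁ , c₂ ∷ ay₂) =
  cong (not c₂ ∧_) (invariant-zeroʸ (ax₁ , ax₂) (ay₁ , ay₂))

invariant-qDiff : ∀ {m} (ax ay : Mat m) → qDiff (invariant ax ay) ≡ Q (ax ⊕ ay)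
invariant-qDiff {zero}  ([] , []) ([] , []) = refl
invariant-qDiff {suc m} (b₁ ∷ ax₁ , b₂ ∷ ax₂) (c₁ ∷ ay₁ , c₂ ∷ ay₂) =
  cong (((b₁ xor c₁) ∧ (b₂ xor c₂)) xor_) (invariant-qDiff (ax₁ , ax₂) (ay₁ , ay₂))

invariant-equal : ∀ {m} (ax ay : Mat m) → equal (invariant ax ay) ≡ true → ax ≡ ay
invariant-equal {zero}  ([] , []) ([] , []) _ = refl
invariant-equal {suc m} (b₁ ∷ ax₁ , b₂ ∷ ax₂) (c₁ ∷ ay₁ , c₂ ∷ ay₂) eq
  with ∧-true {(b₁ ==ᴮ c₁) ∧ (b₂ ==ᴮ c₂)} eq
... | heads , tails with ∧-true {b₁ ==ᴮ c₁} heads | invariant-equal (ax₁ , ax₂) (ay₁ , ay₂) tails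
...   | h₁ , h₂ | refl rewrite ==ᴮ-sound b₁ c₁ h₁ | ==ᴮ-sound b₂ c₂ h₂ = refl

invariant-equal-self : ∀ {m} (a : Mat m) → equal (invariant a a) ≡ true
invariant-equal-self {zero}  ([] , []) = refl
invariant-equal-self {suc m} (false ∷ a₁ , false ∷ a₂) = invariant-equal-self (a₁ , a₂)
invariant-equal-self {suc m} (false ∷ a₁ , true ∷ a₂)  = invariant-equal-self (a₁ , a₂)
invariant-equal-self {suc m} (true ∷ a₁ , false ∷ a₂)  = invariant-equal-self (a₁ , a₂)
invariant-equal-self {suc m} (true ∷ a₁ , true ∷ a₂)   = invariant-equal-self (a₁ , a₂)

invariant-zeroM : ∀ m → invariant (zeroM m) (zeroM m) ≡ initial
invariant-zeroM zero    = refl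
invariant-zeroM (suc m) rewrite invariant-zeroM m = refl

tailCount : (Type → Mat 2 → Bool) → Invariant → Quadratic
tailCount f s = ∑Q[ t ← types ] ((∑[ u ← allMats 2 ] 𝟙 (f t u)) ·Q table s t)

count-by-tail : ∀ m (P : Mat (suc (suc m)) → Bool) (ax ay : Mat m) (f : Type → Mat 2 → Bool) →
  (∀ a s → P (a ++ᴹ s) ≡ f (typeOf ax ay a) s) →
  + (4 * #ᴹ P) ≡ ⟦ tailCount f (invariant ax ay) ⟧ (+ (2 ^ m))
count-by-tail m P ax ay f P≡f = trans (cong (λ k → + (4 * k)) regroup)
  (⟦⟧-∑Q-· (λ t → ∑[ u ← allMats 2 ] 𝟙 (f t u)) (count m ax ay) (table (invariant ax ay)) (+ (2 ^ m)) types
    (proj₂ (count-table m ax ay)))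
  where
  open ≡-Reasoning
  regroup : #ᴹ P ≡ ∑[ t ← types ] (∑[ u ← allMats 2 ] 𝟙 (f t u) * count m ax ay t)
  regroup = begin
    #ᴹ P
      ≡⟨ ∑ᴹ-++ᴹ m _ ⟩
    ∑[ u ← allMats 2 ] ∑ᴹ m (λ a → 𝟙 (P (a ++ᴹ u)))
      ≡⟨ ∑-cong (allMats 2) (λ u → ∑-cong (allMats m) (λ a → cong 𝟙 (P≡f a u))) ⟩
    ∑[ u ← allMats 2 ] ∑ᴹ m (λ a → 𝟙 (f (typeOf ax ay a) u))
      ≡⟨ ∑-cong (allMats 2) (λ u → ∑ᴹ-by-type m ax ay (λ t → 𝟙 (f t u))) ⟩
    ∑[ u ← allMats 2 ] ∑[ t ← types ] (𝟙 (f t u) * count m ax ay t)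
      ≡⟨ ∑-comm (λ u t → 𝟙 (f t u) * count m ax ay t) (allMats 2) types ⟩
    ∑[ t ← types ] ∑[ u ← allMats 2 ] (𝟙 (f t u) * count m ax ay t)
      ≡⟨ ∑-cong types (λ t → ∑-*ʳ (count m ax ay t) (λ u → 𝟙 (f t u)) (allMats 2)) ⟩
    ∑[ t ← types ] (∑[ u ← allMats 2 ] 𝟙 (f t u) * count m ax ay t) ∎

adjΓe2≡adj⁺-distinct : ∀ {m} (x y : Mat (suc (suc m))) → x ≢ y → adjΓe2 x y ≡ adj⁺ x y
adjΓe2≡adj⁺-distinct x y x≢y = trans (adjΓe2≡adj⁺ x y) (cong (λ b → not b ∧ adj⁺ x y) (==ᴹ-complete x≢y))

adjΓe2-irrefl : ∀ {m} (x : Mat (suc (suc m))) → adjΓe2 x x ≡ false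
adjΓe2-irrefl x = trans (adjΓe2≡adj⁺ x x) (cong (λ b → not b ∧ adj⁺ x x) (==ᴹ-refl x))

-- Degrees and common neighbours through the reflexive adjacency

#ᴹ-==ᴹ : ∀ k (x : Mat k) → #ᴹ (x ==ᴹ_) ≡ 1
#ᴹ-==ᴹ zero    ([] , []) = refl
#ᴹ-==ᴹ (suc k) (b₁ ∷ r₁ , b₂ ∷ r₂) =
  trans (∑ᴹ-suc k _) (trans (∑-cong (allMats k) (λ (a₁ , a₂) → column b₁ b₂ (r₁ ==ᴿ a₁) (r₂ ==ᴿ a₂)))
                            (#ᴹ-==ᴹ k (r₁ , r₂)))
  where
  column : ∀ b₁ b₂ u v → ∑[ (c₁ , c₂) ← columns ] 𝟙 (((b₁ ==ᴮ c₁) ∧ u) ∧ ((b₂ ==ᴮ c₂) ∧ v)) ≡ 𝟙 (u ∧ v)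
  column false false false v     = refl
  column false false true  false = refl
  column false false true  true  = refl
  column false true  false v     = refl
  column false true  true  false = refl
  column false true  true  true  = refl
  column true  false false v     = refl
  column true  false true  false = refl
  column true  false true  true  = refl
  column true  true  false v     = refl
  column true  true  true  false = refl
  column true  true  true  true  = refl

#ᴹ-delete : ∀ k (x : Mat k) (P : Mat k → Bool) → #ᴹ (λ z → not (x ==ᴹ z) ∧ P z) + 𝟙 (P x) ≡ #ᴹ P
#ᴹ-delete k x P = begin
  ∑ᴹ k (λ z → 𝟙 (not (x ==ᴹ z) ∧ P z)) + 𝟙 (P x)
    ≡⟨ cong (_+_ (#ᴹ (λ z → not (x ==ᴹ z) ∧ P z))) (sym once) ⟩
  ∑ᴹ k (λ z → 𝟙 (not (x ==ᴹ z) ∧ P z)) + ∑ᴹ k (λ z → 𝟙 (P x) * 𝟙 (x ==ᴹ z))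
    ≡⟨ sym (∑-distrib-+ _ _ (allMats k)) ⟩
  ∑ᴹ k (λ z → 𝟙 (not (x ==ᴹ z) ∧ P z) + 𝟙 (P x) * 𝟙 (x ==ᴹ z))
    ≡⟨ ∑-cong (allMats k) pointwise ⟩
  ∑ᴹ k (λ z → 𝟙 (P z)) ∎
  where
  open ≡-Reasoning
  once : ∑ᴹ k (λ z → 𝟙 (P x) * 𝟙 (x ==ᴹ z)) ≡ 𝟙 (P x)
  once = trans (∑-*ˡ (𝟙 (P x)) _ (allMats k)) (trans (cong (𝟙 (P x) *_) (#ᴹ-==ᴹ k x)) (ℕ.*-identityʳ (𝟙 (P x))))
  pointwise : ∀ z → 𝟙 (not (x ==ᴹ z) ∧ P z) + 𝟙 (P x) * 𝟙 (x ==ᴹ z) ≡ 𝟙 (P z)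
  pointwise z with x ==ᴹ z in eq
  ... | false = trans (cong (_+_ (𝟙 (P z))) (ℕ.*-zeroʳ (𝟙 (P x)))) (ℕ.+-identityʳ (𝟙 (P z)))
  ... | true rewrite ==ᴹ-sound x z eq = ℕ.*-identityʳ (𝟙 (P z))

module _ {m : ℕ} where
  private
    e = suc (suc m)

  degree-adj⁺ : ∀ (x : Mat e) → length (filterᵇ (λ z → adjΓe2 x z) (allMats e)) + 1 ≡ #ᴹ (adj⁺ x)
  degree-adj⁺ x = begin
    length (filterᵇ (λ z → adjΓe2 x z) (allMats e)) + 1
      ≡⟨ cong₂ _+_ (length-filterᵇ (adjΓe2 x) (allMats e)) (cong 𝟙 (sym (adj⁺-refl x))) ⟩
    #ᴹ (adjΓe2 x) + 𝟙 (adj⁺ x x)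
      ≡⟨ cong (_+ 𝟙 (adj⁺ x x)) (∑-cong (allMats e) (λ z → cong 𝟙 (adjΓe2≡adj⁺ x z))) ⟩
    #ᴹ (λ z → not (x ==ᴹ z) ∧ adj⁺ x z) + 𝟙 (adj⁺ x x)
      ≡⟨ #ᴹ-delete e x (adj⁺ x) ⟩
    #ᴹ (adj⁺ x) ∎
    where open ≡-Reasoning

  W₁-degree-adj⁺ : ∀ (x : Mat e) → W₁ x ≡ false →
    length (filterᵇ (λ z → W₁ z ∧ adjΓe2 x z) (allMats e)) ≡ #ᴹ (λ z → W₁ z ∧ adj⁺ x z)
  W₁-degree-adj⁺ x x∉W₁ = begin
    length (filterᵇ (λ z → W₁ z ∧ adjΓe2 x z) (allMats e))
      ≡⟨ length-filterᵇ _ (allMats e) ⟩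
    #ᴹ (λ z → W₁ z ∧ adjΓe2 x z)
      ≡⟨ ∑-cong (allMats e) (λ z → cong 𝟙 (rearrange z)) ⟩
    #ᴹ (λ z → not (x ==ᴹ z) ∧ (W₁ z ∧ adj⁺ x z))
      ≡⟨ sym (ℕ.+-identityʳ _) ⟩
    #ᴹ (λ z → not (x ==ᴹ z) ∧ (W₁ z ∧ adj⁺ x z)) + 𝟙 false
      ≡⟨ cong (λ b → #ᴹ (λ z → not (x ==ᴹ z) ∧ (W₁ z ∧ adj⁺ x z)) + 𝟙 (b ∧ adj⁺ x x)) (sym x∉W₁) ⟩
    #ᴹ (λ z → not (x ==ᴹ z) ∧ (W₁ z ∧ adj⁺ x z)) + 𝟙 (W₁ x ∧ adj⁺ x x)
      ≡⟨ #ᴹ-delete e x (λ z → W₁ z ∧ adj⁺ x z) ⟩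
    #ᴹ (λ z → W₁ z ∧ adj⁺ x z) ∎
    where
    open ≡-Reasoning
    ∧-swap : ∀ a b c → a ∧ (b ∧ c) ≡ b ∧ (a ∧ c)
    ∧-swap false false c = refl
    ∧-swap false true  c = refl
    ∧-swap true  b     c = refl
    rearrange : ∀ z → W₁ z ∧ adjΓe2 x z ≡ not (x ==ᴹ z) ∧ (W₁ z ∧ adj⁺ x z)
    rearrange z = trans (cong (W₁ z ∧_) (adjΓe2≡adj⁺ x z)) (∧-swap (W₁ z) (not (x ==ᴹ z)) (adj⁺ x z))

  common-adj⁺ : ∀ (x y : Mat e) → x ≢ y →
    length (filterᵇ (λ z → adjΓe2 x z ∧ adjΓe2 y z) (allMats e)) + 𝟙 (adj⁺ x y) + 𝟙 (adj⁺ x y)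
      ≡ #ᴹ (λ z → adj⁺ x z ∧ adj⁺ y z)
  common-adj⁺ x y x≢y = begin
    length (filterᵇ (λ z → adjΓe2 x z ∧ adjΓe2 y z) (allMats e)) + 𝟙 (adj⁺ x y) + 𝟙 (adj⁺ x y)
      ≡⟨ cong₃ (λ c b b' → c + 𝟙 b + 𝟙 b') (length-filterᵇ _ (allMats e)) atX atY ⟩
    #ᴹ (λ z → adjΓe2 x z ∧ adjΓe2 y z) + 𝟙 (NotY x) + 𝟙 (Both y)
      ≡⟨ cong (λ c → c + 𝟙 (NotY x) + 𝟙 (Both y)) (∑-cong (allMats e) (λ z → cong 𝟙 (split z))) ⟩
    #ᴹ (λ z → not (x ==ᴹ z) ∧ NotY z) + 𝟙 (NotY x) + 𝟙 (Both y)
      ≡⟨ cong (_+ 𝟙 (Both y)) (#ᴹ-delete e x NotY) ⟩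
    #ᴹ NotY + 𝟙 (Both y)
      ≡⟨ #ᴹ-delete e y Both ⟩
    #ᴹ Both ∎
    where
    open ≡-Reasoning
    cong₃ : ∀ {A B C D : Set} (f : A → B → C → D) {a a' b b' c c'} →
            a ≡ a' → b ≡ b' → c ≡ c' → f a b c ≡ f a' b' c'
    cong₃ f refl refl refl = refl
    Both NotY : Mat e → Bool
    Both z = adj⁺ x z ∧ adj⁺ y z
    NotY z = not (y ==ᴹ z) ∧ Both z
    atX : adj⁺ x y ≡ NotY x
    atX rewrite ==ᴹ-complete (λ y≡x → x≢y (sym y≡x)) | adj⁺-refl x = adj⁺-sym x y
    atY : adj⁺ x y ≡ Both y
    atY rewrite adj⁺-refl y = sym (∧-identityʳ (adj⁺ x y))
    regroup : ∀ a b c d → (a ∧ c) ∧ (b ∧ d) ≡ a ∧ (b ∧ (c ∧ d))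
    regroup false b c d = refl
    regroup true false c d = ∧-zeroʳ c
    regroup true true c d = refl
    split : ∀ z → adjΓe2 x z ∧ adjΓe2 y z ≡ not (x ==ᴹ z) ∧ NotY z
    split z = trans (cong₂ _∧_ (adjΓe2≡adj⁺ x z) (adjΓe2≡adj⁺ y z))
                    (regroup (not (x ==ᴹ z)) (not (y ==ᴹ z)) (adj⁺ x z) (adj⁺ y z))

-- Finite checks over invariants and tails

every-when : ∀ {A} (SA : Searchable A) (cond : Invariant → Bool) (P : Invariant → A → Bool) →
  every Invariant-searchable (λ s → not (cond s) ∨ every SA (P s)) ≡ true →
  ∀ s → cond s ≡ true → ∀ a → P s a ≡ true
every-when SA cond P ok s c =
  every-sound SA (P s) (∨-resolve (every-sound Invariant-searchable (λ s → not (cond s) ∨ every SA (P s)) ok s) (cong not c))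

Mat₂²-searchable : Searchable (Mat 2 × Mat 2)
Mat₂²-searchable = ×-searchable Mat₂-searchable Mat₂-searchable

neighbourType : Bool → Mat 2 → Type → Mat 2 → Bool
neighbourType zx sx (α , _ , γ) s = adjTail zx sx γ s α

W₁-neighbourType : Bool → Mat 2 → Type → Mat 2 → Bool
W₁-neighbourType zx sx (α , _ , γ) s = inW₁ (tailProfile γ s) ∧ adjTail zx sx γ s α

commonType : Bool → Mat 2 → Bool → Mat 2 → Type → Mat 2 → Bool
commonType zx sx zy sy (α , β , γ) s = adjTail zx sx γ s α ∧ adjTail zy sy γ s β

λ-poly μ⁻-poly μ-poly μ⁺-poly : Quadratic
λ-poly  = + 16 N²+ + 8 N
μ⁻-poly = + 16 N²+ + 0 N
μ-poly  = + 16 N²+ + 8 N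
μ⁺-poly = + 16 N²+ + 16 N

classify : Bool → Quadratic → Bool
classify true  p = p ==Q λ-poly
classify false p = (p ==Q μ⁻-poly) ∨ (p ==Q μ-poly) ∨ (p ==Q μ⁺-poly)

classify-true : ∀ p → classify true p ≡ true → p ≡ λ-poly
classify-true p h = ==Q-sound p λ-poly h

classify-false : ∀ p → classify false p ≡ true → p ≡ μ⁻-poly ⊎ p ≡ μ-poly ⊎ p ≡ μ⁺-poly
classify-false p h with p ==Q μ⁻-poly in e₁ | p ==Q μ-poly in e₂
... | true  | _    = inj₁ (==Q-sound p μ⁻-poly e₁)
... | false | true = inj₂ (inj₁ (==Q-sound p μ-poly e₂))
... | false | false = inj₂ (inj₂ (==Q-sound p μ⁺-poly h))

selfPair : Invariant → Bool
selfPair s = admissible s ∧ equal s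

degreeHolds : Invariant → Mat 2 → Bool
degreeHolds s sx = tailCount (neighbourType (zeroˣ s) sx) s ==Q (+ 32 N²+ + 8 N)

W₁-degreeHolds : Invariant → Mat 2 → Bool
W₁-degreeHolds s sx =
  inW₁ (tailProfile (zeroˣ s) sx) ∨ tailCount (W₁-neighbourType (zeroˣ s) sx) s ==Q (+ 0 N²+ + 8 N)

commonHolds : Invariant → Mat 2 × Mat 2 → Bool
commonHolds s (sx , sy) = (equal s ∧ (sx ==ᴹ sy)) ∨
  classify (adjTail (zeroˣ s) sx (zeroʸ s) sy (qDiff s)) (tailCount (commonType (zeroˣ s) sx (zeroʸ s) sy) s)

degree-check : every Invariant-searchable (λ s → not (selfPair s) ∨ every Mat₂-searchable (degreeHolds s)) ≡ true
degree-check = refl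

W₁-degree-check : every Invariant-searchable (λ s → not (selfPair s) ∨ every Mat₂-searchable (W₁-degreeHolds s)) ≡ true
W₁-degree-check = refl

common-check : every Invariant-searchable (λ s → not (admissible s) ∨ every Mat₂²-searchable (commonHolds s)) ≡ true
common-check = refl

degree-table : ∀ s → selfPair s ≡ true → ∀ sx → tailCount (neighbourType (zeroˣ s) sx) s ≡ + 32 N²+ + 8 N
degree-table s ok sx = ==Q-sound (tailCount (neighbourType (zeroˣ s) sx) s) (+ 32 N²+ + 8 N)
  (every-when Mat₂-searchable selfPair degreeHolds degree-check s ok sx)

W₁-degree-table : ∀ s → selfPair s ≡ true → ∀ sx → inW₁ (tailProfile (zeroˣ s) sx) ≡ false →
  tailCount (W₁-neighbourType (zeroˣ s) sx) s ≡ + 0 N²+ + 8 N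
W₁-degree-table s ok sx outside = ==Q-sound (tailCount (W₁-neighbourType (zeroˣ s) sx) s) (+ 0 N²+ + 8 N)
  (∨-resolve (every-when Mat₂-searchable selfPair W₁-degreeHolds W₁-degree-check s ok sx) outside)

common-table : ∀ s → admissible s ≡ true → ∀ sx sy → equal s ∧ (sx ==ᴹ sy) ≡ false →
  classify (adjTail (zeroˣ s) sx (zeroʸ s) sy (qDiff s)) (tailCount (commonType (zeroˣ s) sx (zeroʸ s) sy) s) ≡ true
common-table s ok sx sy distinct =
  ∨-resolve (every-when Mat₂²-searchable admissible commonHolds common-check s ok (sx , sy)) distinct

cliqueHolds : Mat 2 × Mat 2 → Bool
cliqueHolds (sx , sy) = not (isZero (proj₂ sx) ∧ isZero (proj₂ sy)) ∨ adjTail true sx true sy false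

clique-check : every Mat₂²-searchable cliqueHolds ≡ true
clique-check = refl

clique-table : ∀ sx sy → isZero (proj₂ sx) ≡ true → isZero (proj₂ sy) ≡ true → adjTail true sx true sy false ≡ true
clique-table sx sy zsx zsy = ∨-resolve (every-sound Mat₂²-searchable cliqueHolds clique-check (sx , sy)) (cong not (cong₂ _∧_ zsx zsy))

selfPair-invariant : ∀ {m} (a : Mat m) → selfPair (invariant a a) ≡ true
selfPair-invariant {m} a = cong₂ _∧_ (proj₁ (count-table m a a)) (invariant-equal-self a)

module _ {m : ℕ} where
  private
    n = + (2 ^ m)

  degree-poly-++ᴹ : ∀ (ax : Mat m) sx → + (4 * #ᴹ (adj⁺ (ax ++ᴹ sx))) ≡ ⟦ + 32 N²+ + 8 N ⟧ n
  degree-poly-++ᴹ ax sx = begin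
    + (4 * #ᴹ (adj⁺ (ax ++ᴹ sx)))
      ≡⟨ count-by-tail m _ ax ax (neighbourType (isZero₂ ax) sx) (adj⁺-++ᴹ ax sx) ⟩
    ⟦ tailCount (neighbourType (isZero₂ ax) sx) s ⟧ n
      ≡⟨ cong (λ z → ⟦ tailCount (neighbourType z sx) s ⟧ n) (sym (invariant-zeroˣ ax ax)) ⟩
    ⟦ tailCount (neighbourType (zeroˣ s) sx) s ⟧ n
      ≡⟨ cong (λ p → ⟦ p ⟧ n) (degree-table s (selfPair-invariant ax) sx) ⟩
    ⟦ + 32 N²+ + 8 N ⟧ n ∎
    where
    open ≡-Reasoning
    s = invariant ax ax

  W₁-degree-poly-++ᴹ : ∀ (ax : Mat m) sx → W₁ (ax ++ᴹ sx) ≡ false →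
    + (4 * #ᴹ (λ z → W₁ z ∧ adj⁺ (ax ++ᴹ sx) z)) ≡ ⟦ + 0 N²+ + 8 N ⟧ n
  W₁-degree-poly-++ᴹ ax sx x∉W₁ = begin
    + (4 * #ᴹ (λ z → W₁ z ∧ adj⁺ (ax ++ᴹ sx) z))
      ≡⟨ count-by-tail m _ ax ax (W₁-neighbourType (isZero₂ ax) sx)
           (λ a t → cong₂ _∧_ (cong inW₁ (profile-++ᴹ a t)) (adj⁺-++ᴹ ax sx a t)) ⟩
    ⟦ tailCount (W₁-neighbourType (isZero₂ ax) sx) s ⟧ n
      ≡⟨ cong (λ z → ⟦ tailCount (W₁-neighbourType z sx) s ⟧ n) (sym zx) ⟩
    ⟦ tailCount (W₁-neighbourType (zeroˣ s) sx) s ⟧ n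
      ≡⟨ cong (λ p → ⟦ p ⟧ n) (W₁-degree-table s (selfPair-invariant ax) sx outside) ⟩
    ⟦ + 0 N²+ + 8 N ⟧ n ∎
    where
    open ≡-Reasoning
    s = invariant ax ax
    zx = invariant-zeroˣ ax ax
    outside : inW₁ (tailProfile (zeroˣ s) sx) ≡ false
    outside = trans (cong (λ z → inW₁ (tailProfile z sx)) zx) (trans (cong inW₁ (sym (profile-++ᴹ ax sx))) x∉W₁)

  CommonPoly : Mat (suc (suc m)) → Mat (suc (suc m)) → Set
  CommonPoly x y = Σ Quadratic λ p → classify (adj⁺ x y) p ≡ true × + (4 * #ᴹ (λ z → adj⁺ x z ∧ adj⁺ y z)) ≡ ⟦ p ⟧ n

  common-poly-++ᴹ : ∀ (ax : Mat m) sx ay sy → ax ++ᴹ sx ≢ ay ++ᴹ sy → CommonPoly (ax ++ᴹ sx) (ay ++ᴹ sy)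
  common-poly-++ᴹ ax sx ay sy x≢y = p , classified , counted
    where
    s = invariant ax ay
    zx = invariant-zeroˣ ax ay
    zy = invariant-zeroʸ ax ay
    p = tailCount (commonType (zeroˣ s) sx (zeroʸ s) sy) s
    distinct : equal s ∧ (sx ==ᴹ sy) ≡ false
    distinct with equal s in eq | sx ==ᴹ sy in eq'
    ... | false | _     = refl
    ... | true  | false = refl
    ... | true  | true  = ⊥-elim (x≢y (cong₂ _++ᴹ_ (invariant-equal ax ay eq) (==ᴹ-sound sx sy eq')))
    adjacency : adjTail (zeroˣ s) sx (zeroʸ s) sy (qDiff s) ≡ adj⁺ (ax ++ᴹ sx) (ay ++ᴹ sy)
    adjacency rewrite zx | zy | invariant-qDiff ax ay = sym (adj⁺-++ᴹ ax sx ay sy)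
    classified : classify (adj⁺ (ax ++ᴹ sx) (ay ++ᴹ sy)) p ≡ true
    classified = subst (λ b → classify b p ≡ true) adjacency (common-table s (proj₁ (count-table m ax ay)) sx sy distinct)
    counted : + (4 * #ᴹ (λ z → adj⁺ (ax ++ᴹ sx) z ∧ adj⁺ (ay ++ᴹ sy) z)) ≡ ⟦ p ⟧ n
    counted = trans (count-by-tail m _ ax ay (commonType (isZero₂ ax) sx (isZero₂ ay) sy)
                      (λ a t → cong₂ _∧_ (adj⁺-++ᴹ ax sx a t) (adj⁺-++ᴹ ay sy a t)))
                    (cong₂ (λ zx' zy' → ⟦ tailCount (commonType zx' sx zy' sy) s ⟧ n) (sym zx) (sym zy))

  degree-poly : ∀ x → + (4 * #ᴹ (adj⁺ x)) ≡ ⟦ + 32 N²+ + 8 N ⟧ n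
  degree-poly = ++ᴹ-elim (λ x → + (4 * #ᴹ (adj⁺ x)) ≡ ⟦ + 32 N²+ + 8 N ⟧ n) degree-poly-++ᴹ

  W₁-degree-poly : ∀ x → W₁ x ≡ false → + (4 * #ᴹ (λ z → W₁ z ∧ adj⁺ x z)) ≡ ⟦ + 0 N²+ + 8 N ⟧ n
  W₁-degree-poly = ++ᴹ-elim (λ x → W₁ x ≡ false → + (4 * #ᴹ (λ z → W₁ z ∧ adj⁺ x z)) ≡ ⟦ + 0 N²+ + 8 N ⟧ n)
                            W₁-degree-poly-++ᴹ

  common-poly : ∀ x y → x ≢ y → CommonPoly x y
  common-poly = ++ᴹ-elim (λ x → ∀ y → x ≢ y → CommonPoly x y)
                  (λ ax sx → ++ᴹ-elim (λ y → ax ++ᴹ sx ≢ y → CommonPoly (ax ++ᴹ sx) y) (common-poly-++ᴹ ax sx))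

W₁-adjacent-++ᴹ : ∀ {m} (ax : Mat m) sx ay sy → W₁ (ax ++ᴹ sx) ≡ true → W₁ (ay ++ᴹ sy) ≡ true →
  ax ++ᴹ sx ≢ ay ++ᴹ sy → adjΓe2 (ax ++ᴹ sx) (ay ++ᴹ sy) ≡ true
W₁-adjacent-++ᴹ ax sx ay sy x∈W₁ y∈W₁ x≢y =
  adjacent (∧-true (trans (sym (W₁-++ᴹ ax sx)) x∈W₁)) (∧-true (trans (sym (W₁-++ᴹ ay sy)) y∈W₁))
  where
  open ≡-Reasoning
  adjacent : isZero₂ ax ≡ true × isZero (proj₂ sx) ≡ true → isZero₂ ay ≡ true × isZero (proj₂ sy) ≡ true →
             adjΓe2 (ax ++ᴹ sx) (ay ++ᴹ sy) ≡ true
  adjacent (zx , zsx) (zy , zsy) = begin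
    adjΓe2 (ax ++ᴹ sx) (ay ++ᴹ sy)                         ≡⟨ adjΓe2≡adj⁺-distinct _ _ x≢y ⟩
    adj⁺ (ax ++ᴹ sx) (ay ++ᴹ sy)                           ≡⟨ adj⁺-++ᴹ ax sx ay sy ⟩
    adjTail (isZero₂ ax) sx (isZero₂ ay) sy (Q (ax ⊕ ay))   ≡⟨ cong₂ (λ a b → adjTail a sx b sy (Q (ax ⊕ ay))) zx zy ⟩
    adjTail true sx true sy (Q (ax ⊕ ay))                  ≡⟨ cong (adjTail true sx true sy) (Q-⊕-isZero₂ ax ay zx zy) ⟩
    adjTail true sx true sy false                          ≡⟨ clique-table sx sy zsx zsy ⟩
    true                                                   ∎

cancel-4 : ∀ a b → 4 * a ≡ 4 * b → a ≡ b
cancel-4 a b = ℕ.*-cancelˡ-≡ a b 4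

degree-arith : ∀ n d → 0 < n → 4 * (d + 1) ≡ 32 * (n * n) + 8 * n → d ≡ (2 * n + 1) * (2 * (2 * n) ∸ 1)
degree-arith (suc P) d _ h = ℕ.+-cancelʳ-≡ 1 d _ (cancel-4 _ _ (trans h (sym expand)))
  where
  double : ∀ P → 2 * (2 * suc P) ≡ suc (4 * P + 3)
  double = solve-∀
  identity : ∀ P → 4 * ((2 * suc P + 1) * (4 * P + 3) + 1) ≡ 32 * (suc P * suc P) + 8 * suc P
  identity = solve-∀
  expand : 4 * ((2 * suc P + 1) * (2 * (2 * suc P) ∸ 1) + 1) ≡ 32 * (suc P * suc P) + 8 * suc P
  expand = trans (cong (λ k → 4 * ((2 * suc P + 1) * (k ∸ 1) + 1)) (double P)) (identity P)

λ-arith : ∀ n c → 0 < n → 4 * (c + 1 + 1) ≡ 16 * (n * n) + 8 * n → c ≡ 2 * ((n + 1) * (2 * n ∸ 1))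
λ-arith (suc P) c _ h = ℕ.+-cancelʳ-≡ 2 c _ (cancel-4 _ _ (trans (assoc c) (trans h (sym expand))))
  where
  assoc : ∀ c → 4 * (c + 2) ≡ 4 * (c + 1 + 1)
  assoc = solve-∀
  double : ∀ P → 2 * suc P ≡ suc (2 * P + 1)
  double = solve-∀
  identity : ∀ P → 4 * (2 * ((suc P + 1) * (2 * P + 1)) + 2) ≡ 16 * (suc P * suc P) + 8 * suc P
  identity = solve-∀
  expand : 4 * (2 * ((suc P + 1) * (2 * suc P ∸ 1)) + 2) ≡ 16 * (suc P * suc P) + 8 * suc P
  expand = trans (cong (λ k → 4 * (2 * ((suc P + 1) * (k ∸ 1)) + 2)) (double P)) (identity P)

μ⁻-arith : ∀ n c → 4 * (c + 0 + 0) ≡ 16 * (n * n) + 0 * n → c ≡ 2 * n * (2 * n + 1) ∸ 2 * n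
μ⁻-arith n c h = trans (sym (ℕ.m+n∸n≡m c (2 * n))) (cong (_∸ 2 * n) (cancel-4 _ _ (begin
  4 * (c + 2 * n)               ≡⟨ shift c n ⟩
  4 * (c + 0 + 0) + 8 * n        ≡⟨ cong (_+ 8 * n) h ⟩
  16 * (n * n) + 0 * n + 8 * n   ≡⟨ identity n ⟩
  4 * (2 * n * (2 * n + 1))      ∎)))
  where
  open ≡-Reasoning
  shift : ∀ c n → 4 * (c + 2 * n) ≡ 4 * (c + 0 + 0) + 8 * n
  shift = solve-∀
  identity : ∀ n → 16 * (n * n) + 0 * n + 8 * n ≡ 4 * (2 * n * (2 * n + 1))
  identity = solve-∀

μ-arith : ∀ n c → 4 * (c + 0 + 0) ≡ 16 * (n * n) + 8 * n → c ≡ 2 * n * (2 * n + 1)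
μ-arith n c h = cancel-4 _ _ (trans (pad c) (trans h (identity n)))
  where
  pad : ∀ c → 4 * c ≡ 4 * (c + 0 + 0)
  pad = solve-∀
  identity : ∀ n → 16 * (n * n) + 8 * n ≡ 4 * (2 * n * (2 * n + 1))
  identity = solve-∀

μ⁺-arith : ∀ n c → 4 * (c + 0 + 0) ≡ 16 * (n * n) + 16 * n → c ≡ 2 * n * (2 * n + 1) + 2 * n
μ⁺-arith n c h = cancel-4 _ _ (trans (pad c) (trans h (identity n)))
  where
  pad : ∀ c → 4 * c ≡ 4 * (c + 0 + 0)
  pad = solve-∀
  identity : ∀ n → 16 * (n * n) + 16 * n ≡ 4 * (2 * n * (2 * n + 1) + 2 * n)
  identity = solve-∀

W₁-degree-arith : ∀ n c → 4 * c ≡ 0 * (n * n) + 8 * n → c ≡ 2 * n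
W₁-degree-arith n c h = cancel-4 _ _ (trans h (identity n))
  where
  identity : ∀ n → 0 * (n * n) + 8 * n ≡ 4 * (2 * n)
  identity = solve-∀

W₁-card-arith : ∀ n c → 4 * c ≡ 0 * (n * n) + 16 * n → c ≡ 2 * (2 * n)
W₁-card-arith n c h = cancel-4 _ _ (trans h (identity n))
  where
  identity : ∀ n → 0 * (n * n) + 16 * n ≡ 4 * (2 * (2 * n))
  identity = solve-∀

order-arith : ∀ m c → 4 * c ≡ 64 * (2 ^ m * 2 ^ m) + 0 * 2 ^ m → c ≡ 2 ^ (2 * suc (suc m))
order-arith m c h = cancel-4 _ _ (trans h (begin
  64 * (2 ^ m * 2 ^ m) + 0 * 2 ^ m   ≡⟨ identity (2 ^ m) ⟩
  4 * (16 * (2 ^ m * 2 ^ m))        ≡⟨ cong (λ k → 4 * (16 * k)) (sym (ℕ.^-distribˡ-+-* 2 m m)) ⟩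
  4 * (16 * 2 ^ (m + m))            ≡⟨ cong (4 *_) (trans (sixteen (2 ^ (m + m))) (cong (2 ^_) (exponent m))) ⟩
  4 * 2 ^ (2 * suc (suc m))         ∎))
  where
  open ≡-Reasoning
  identity : ∀ n → 64 * (n * n) + 0 * n ≡ 4 * (16 * (n * n))
  identity = solve-∀
  sixteen : ∀ k → 16 * k ≡ 2 * (2 * (2 * (2 * k)))
  sixteen = solve-∀
  exponent : ∀ m → 4 + (m + m) ≡ 2 * suc (suc m)
  exponent = solve-∀

module Γ (m : ℕ) where
  open GraphNotions (allMats (suc (suc m))) adjΓe2

  N h λΓ μΓ : ℕ
  N  = 2 ^ m
  h  = 2 * N
  λΓ = 2 * ((N + 1) * (2 * N ∸ 1))
  μΓ = 2 * N * (2 * N + 1)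

  N>0 : 0 < N
  N>0 = ℕ.m^n>0 2 m

  count-initial : ∀ (P : Mat (suc (suc m)) → Bool) f → (∀ a s → P (a ++ᴹ s) ≡ f (typeOf (zeroM m) (zeroM m) a) s) →
    + (4 * #ᴹ P) ≡ ⟦ tailCount f initial ⟧ (+ N)
  count-initial P f P≡f = trans (count-by-tail m P (zeroM m) (zeroM m) f P≡f)
                                (cong (λ s → ⟦ tailCount f s ⟧ (+ N)) (invariant-zeroM m))

  order-Γ : order ≡ 2 ^ (2 * suc (suc m))
  order-Γ = order-arith m order (unscale 64 0 N order refl (begin
    + (4 * order)                                ≡⟨ cong (λ k → + (4 * k)) (length≡∑1 (allMats (suc (suc m)))) ⟩
    + (4 * #ᴹ {suc (suc m)} (λ _ → true))        ≡⟨ count-initial (λ _ → true) all (λ _ _ → refl) ⟩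
    ⟦ tailCount all initial ⟧ (+ N)              ≡⟨ cong (λ p → ⟦ p ⟧ (+ N)) all-count ⟩
    ⟦ + 64 N²+ + 0 N ⟧ (+ N)                     ∎))
    where
    open ≡-Reasoning
    all : Type → Mat 2 → Bool
    all _ _ = true
    all-count : tailCount all initial ≡ + 64 N²+ + 0 N
    all-count = refl

  regular-Γ : IsRegular ((2 * N + 1) * (2 * (2 * N) ∸ 1))
  regular-Γ x = degree-arith N (deg x) N>0 (unscale 32 8 N (deg x + 1) refl
    (trans (cong (λ k → + (4 * k)) (degree-adj⁺ x)) (degree-poly x)))

  CommonEquation : ℕ → Bool → Set
  CommonEquation c b = Σ Quadratic λ p → classify b p ≡ true × + (4 * (c + 𝟙 b + 𝟙 b)) ≡ ⟦ p ⟧ (+ N)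

  common-equation : ∀ x y → x ≢ y → CommonEquation (common x y) (adj⁺ x y)
  common-equation x y x≢y = add-adjacent (common-poly x y x≢y)
    where
    add-adjacent : CommonPoly x y → CommonEquation (common x y) (adj⁺ x y)
    add-adjacent (p , classified , counted) =
      p , classified , trans (cong (λ k → + (4 * k)) (common-adj⁺ x y x≢y)) counted

  MuCases : ℕ → Set
  MuCases c = c ≡ μΓ ∸ h ⊎ c ≡ μΓ ⊎ c ≡ μΓ + h

  λ-solve : ∀ c → CommonEquation c true → c ≡ λΓ
  λ-solve c (p , classified , counted) = λ-arith N c N>0 (unscale 16 8 N (c + 1 + 1) (classify-true p classified) counted)

  μ-solve : ∀ c → CommonEquation c false → MuCases c
  μ-solve c (p , classified , counted) with classify-false p classified
  ... | inj₁ p≡μ⁻        = inj₁ (μ⁻-arith N c (unscale 16 0 N (c + 0 + 0) p≡μ⁻ counted))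
  ... | inj₂ (inj₁ p≡μ)  = inj₂ (inj₁ (μ-arith N c (unscale 16 8 N (c + 0 + 0) p≡μ counted)))
  ... | inj₂ (inj₂ p≡μ⁺) = inj₂ (inj₂ (μ⁺-arith N c (unscale 16 16 N (c + 0 + 0) p≡μ⁺ counted)))

  λ-Γ : ∀ x y → adjΓe2 x y ≡ true → common x y ≡ λΓ
  λ-Γ x y adj = λ-solve (common x y) (subst (CommonEquation (common x y)) adj⁺-true (common-equation x y x≢y))
    where
    x≢y : x ≢ y
    x≢y refl with trans (sym (adjΓe2-irrefl x)) adj
    ... | ()
    adj⁺-true : adj⁺ x y ≡ true
    adj⁺-true = trans (sym (adjΓe2≡adj⁺-distinct x y x≢y)) adj

  μ-Γ : ∀ x y → x ≢ y → adjΓe2 x y ≡ false → MuCases (common x y)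
  μ-Γ x y x≢y nonadj = μ-solve (common x y) (subst (CommonEquation (common x y)) adj⁺-false (common-equation x y x≢y))
    where
    adj⁺-false : adj⁺ x y ≡ false
    adj⁺-false = trans (sym (adjΓe2≡adj⁺-distinct x y x≢y)) nonadj

  W₁-clique : IsClique W₁
  W₁-clique = ++ᴹ-elim (λ x → ∀ y → W₁ x ≡ true → W₁ y ≡ true → x ≢ y → adjΓe2 x y ≡ true)
    λ ax sx → ++ᴹ-elim (λ y → W₁ (ax ++ᴹ sx) ≡ true → W₁ y ≡ true → ax ++ᴹ sx ≢ y → adjΓe2 (ax ++ᴹ sx) y ≡ true)
                       (W₁-adjacent-++ᴹ ax sx)

  W₁-degree : Mat (suc (suc m)) → ℕ
  W₁-degree x = length (filterᵇ (λ s → W₁ s ∧ adjΓe2 x s) (allMats (suc (suc m))))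

  W₁-regular : ∀ x → W₁ x ≡ false → W₁-degree x ≡ 2 * N
  W₁-regular x x∉W₁ = W₁-degree-arith N (W₁-degree x) (unscale 0 8 N (W₁-degree x) refl
    (trans (cong (λ k → + (4 * k)) (W₁-degree-adj⁺ x x∉W₁)) (W₁-degree-poly x x∉W₁)))

  W₁-regularClique : IsRegularClique (2 * N) W₁
  W₁-regularClique = W₁-clique , ℕ.*-monoʳ-< 2 N>0 , W₁-regular

  W₁-card : card W₁ ≡ 2 * (2 * N)
  W₁-card = W₁-card-arith N (card W₁) (unscale 0 16 N (card W₁) refl (begin
    + (4 * card W₁)                              ≡⟨ cong (λ k → + (4 * k)) (length-filterᵇ W₁ (allMats (suc (suc m)))) ⟩
    + (4 * #ᴹ {suc (suc m)} W₁)                  ≡⟨ count-initial W₁ inW₁ᵀ (λ a s → cong inW₁ (profile-++ᴹ a s)) ⟩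
    ⟦ tailCount inW₁ᵀ initial ⟧ (+ N)            ≡⟨ cong (λ p → ⟦ p ⟧ (+ N)) W₁-count ⟩
    ⟦ + 0 N²+ + 16 N ⟧ (+ N)                     ∎))
    where
    open ≡-Reasoning
    inW₁ᵀ : Type → Mat 2 → Bool
    inW₁ᵀ (_ , _ , γ) s = inW₁ (tailProfile γ s)
    W₁-count : tailCount inW₁ᵀ initial ≡ + 0 N²+ + 16 N
    W₁-count = refl

  NonadjacentPair : (ℕ → Set) → Set
  NonadjacentPair P = ∃ λ x → ∃ λ y → x ≢ y × adjΓe2 x y ≡ false × P (common x y)

  map-pair : ∀ {P P' : ℕ → Set} → (∀ {c} → P c → P' c) → NonadjacentPair P → NonadjacentPair P'
  map-pair f (x , y , x≢y , nonadj , p) = x , y , x≢y , nonadj , f p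

  -- With zero fronts the invariant is `initial`, so the count is a closed computation.
  zeroPair : ∀ (sy : Mat 2) a b → (zeroM 2 ==ᴹ sy) ≡ false → adjTail true (zeroM 2) true sy false ≡ false →
    tailCount (commonType true (zeroM 2) true sy) initial ≡ + a N²+ + b N →
    NonadjacentPair (λ c → 4 * (c + 0 + 0) ≡ a * (N * N) + b * N)
  zeroPair sy a b distinct nonadj table-value =
    x , y , x≢y , trans (adjΓe2≡adj⁺-distinct x y x≢y) adj⁺-false , unscale a b N (common x y + 0 + 0) table-value counted
    where
    x y : Mat (suc (suc m))
    x = zeroM m ++ᴹ zeroM 2
    y = zeroM m ++ᴹ sy
    x≢y : x ≢ y
    x≢y x≡y = true≢false (trans (sym (==ᴹ-refl (zeroM 2))) (trans (cong (zeroM 2 ==ᴹ_) tails) distinct))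
      where
      tails : zeroM 2 ≡ sy
      tails = trans (sym (lastᴹ-++ᴹ (zeroM m) (zeroM 2))) (trans (cong lastᴹ x≡y) (lastᴹ-++ᴹ (zeroM m) sy))
    z = isZero-zeroRow m
    adj⁺-false : adj⁺ x y ≡ false
    adj⁺-false = trans (adj⁺-++ᴹ (zeroM m) (zeroM 2) (zeroM m) sy)
      (trans (cong₂ (λ b q → adjTail b (zeroM 2) b sy q) z (Q-self (zeroM m))) nonadj)
    counted : + (4 * (common x y + 0 + 0)) ≡ ⟦ tailCount (commonType true (zeroM 2) true sy) initial ⟧ (+ N)
    counted = begin
      + (4 * (common x y + 0 + 0))
        ≡⟨ cong (λ b → + (4 * (common x y + 𝟙 b + 𝟙 b))) (sym adj⁺-false) ⟩
      + (4 * (common x y + 𝟙 (adj⁺ x y) + 𝟙 (adj⁺ x y)))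
        ≡⟨ cong (λ k → + (4 * k)) (common-adj⁺ x y x≢y) ⟩
      + (4 * #ᴹ (λ w → adj⁺ x w ∧ adj⁺ y w))
        ≡⟨ count-initial _ (commonType (isZero₂ (zeroM m)) (zeroM 2) (isZero₂ (zeroM m)) sy)
             (λ a t → cong₂ _∧_ (adj⁺-++ᴹ (zeroM m) (zeroM 2) a t) (adj⁺-++ᴹ (zeroM m) sy a t)) ⟩
      ⟦ tailCount (commonType (isZero₂ (zeroM m)) (zeroM 2) (isZero₂ (zeroM m)) sy) initial ⟧ (+ N)
        ≡⟨ cong (λ b → ⟦ tailCount (commonType b (zeroM 2) b sy) initial ⟧ (+ N)) z ⟩
      ⟦ tailCount (commonType true (zeroM 2) true sy) initial ⟧ (+ N) ∎
      where open ≡-Reasoning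

  pair-μ⁻ : NonadjacentPair (λ c → c ≡ μΓ ∸ h)
  pair-μ⁻ = map-pair (λ {c} → μ⁻-arith N c) (zeroPair ((false ∷ false ∷ []) , (false ∷ true ∷ [])) 16 0 refl refl refl)

  pair-μ : NonadjacentPair (λ c → c ≡ μΓ)
  pair-μ = map-pair (λ {c} → μ-arith N c) (zeroPair ((false ∷ true ∷ []) , (true ∷ true ∷ [])) 16 8 refl refl refl)

  pair-μ⁺ : NonadjacentPair (λ c → c ≡ μΓ + h)
  pair-μ⁺ = map-pair (λ {c} → μ⁺-arith N c) (zeroPair ((true ∷ false ∷ []) , (false ∷ true ∷ [])) 16 16 refl refl refl)

  has-edge : HasEdge
  has-edge = x , y , W₁-clique x y (in-W₁ (zeroRow 2)) (in-W₁ (true ∷ false ∷ [])) x≢y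
    where
    in-W₁ : ∀ s₁ → W₁ (zeroM m ++ᴹ (s₁ , zeroRow 2)) ≡ true
    in-W₁ s₁ = trans (W₁-++ᴹ (zeroM m) (s₁ , zeroRow 2)) (cong (_∧ true) (isZero-zeroRow m))
    x y : Mat (suc (suc m))
    x = zeroM m ++ᴹ (zeroRow 2 , zeroRow 2)
    y = zeroM m ++ᴹ ((true ∷ false ∷ []) , zeroRow 2)
    x≢y : x ≢ y
    x≢y x≡y with trans (sym (lastᴹ-++ᴹ (zeroM m) (zeroRow 2 , zeroRow 2)))
                       (trans (cong lastᴹ x≡y) (lastᴹ-++ᴹ (zeroM m) ((true ∷ false ∷ []) , zeroRow 2)))
    ... | ()

  not-complete : ¬ IsComplete
  not-complete complete =
    let x , y , x≢y , nonadj , _ = pair-μ in true≢false (trans (sym (complete x y x≢y)) nonadj)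

  not-strongly-regular : ¬ IsStronglyRegular
  not-strongly-regular (_ , _ , μ₀ , constant) =
    let x , y , x≢y , nonadj , μxy = pair-μ
        x' , y' , x'≢y' , nonadj' , μ⁺x'y' = pair-μ⁺
        μ≡μ+h = trans (sym μxy) (trans (constant x y x≢y nonadj) (trans (sym (constant x' y' x'≢y' nonadj')) μ⁺x'y'))
        h≡0 = sym (ℕ.+-cancelˡ-≡ μΓ 0 h (trans (ℕ.+-identityʳ μΓ) μ≡μ+h))
    in ℕ.<-irrefl refl (subst (0 <_) h≡0 (ℕ.*-monoʳ-< 2 N>0))

theorem20 : (e : ℕ) → 2 ≤ e →
    let open GraphNotions (allMats e) adjΓe2
        μ = 2 ^ (e ∸ 1) * (2 ^ (e ∸ 1) + 1)
        h = 2 ^ (e ∸ 1)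
    in IsStrictlyNeumaier
       × IsEdgeRegular (2 ^ (2 * e)) ((2 ^ (e ∸ 1) + 1) * (2 ^ e ∸ 1))
           (2 * ((2 ^ (e ∸ 2) + 1) * (2 ^ (e ∸ 1) ∸ 1)))
       × (∃ λ S → IsRegularClique (2 ^ (e ∸ 1)) S × card S ≡ 2 ^ e)
       × (∀ x y → x ≢ y → adjΓe2 x y ≡ false →
            common x y ≡ μ ∸ h ⊎ common x y ≡ μ ⊎ common x y ≡ μ + h)
       × (∃ λ x → ∃ λ y → x ≢ y × adjΓe2 x y ≡ false × common x y ≡ μ ∸ h)
       × (∃ λ x → ∃ λ y → x ≢ y × adjΓe2 x y ≡ false × common x y ≡ μ)
       × (∃ λ x → ∃ λ y → x ≢ y × adjΓe2 x y ≡ false × common x y ≡ μ + h)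
theorem20 (suc (suc m)) (s≤s (s≤s z≤n)) =
    (not-complete , (order , k , λΓ , edge-regular) , (2 * N , W₁ , W₁-regularClique) , not-strongly-regular)
  , edge-regular
  , (W₁ , W₁-regularClique , W₁-card)
  , μ-Γ , pair-μ⁻ , pair-μ , pair-μ⁺
  where
  open Γ m
  open GraphNotions (allMats (suc (suc m))) adjΓe2 using (IsEdgeRegular)
  order k : ℕ
  order = 2 ^ (2 * suc (suc m))
  k = (2 * N + 1) * (2 * (2 * N) ∸ 1)
  edge-regular : IsEdgeRegular order k λΓ
  edge-regular = order-Γ , has-edge , regular-Γ , λ-Γ
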